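{- Let $G$ be a finite connected simple graph and let $v,w\in V(G)$ be two distinct vertices such that $N_G(w)\subseteq N_G[v]$. Suppose that $v_1,v_2\in N_G(v)\setminus N_G[w]$ are two distinct vertices that are joined by a path $P^*$ in $G$ with $V(P^*)\cap (N_G[w]\cup\{v\})=\emptyset$. Let $G(v\xrightarrow{v_1} w)$ denote the graph obtained from $G$ by deleting the edge $vv_1$ and adding the edge $wv_1$. Then $\tau(G(v\xrightarrow{v_1} w))>\tau(G)$.
   Context: For a graph $G$, $\tau(G)$ denotes the number of spanning trees of $G$. $N_G(x)$ is the set of neighbours of $x$ in $G$ and $N_G[x]=N_G(x)\cup\{x\}$. -}

module Defs where

open import Data.Bool using (Bool; true; false; _∧_; _∨_; not; if_then_else_)
open import Data.Nat using (ℕ; zero; suc; _<ᵇ_)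
open import Data.Fin using (Fin; toℕ; _≟_)
open import Data.List using (List; []; _∷_; map; concatMap; length; filterᵇ; allFin; _++_)
open import Data.Bool.ListAction using (any; all)
open import Data.Product using (_×_; _,_)
open import Relation.Nullary using (does)

-- A graph on the vertex set Fin n, given by its adjacency relation.
-- (Simplicity = symmetric + irreflexive is imposed as a hypothesis, see SimpleGraph.)
Graph : ℕ → Set
Graph n = Fin n → Fin n → Bool

Edge : ℕ → Set
Edge n = Fin n × Fin n

_==_ : ∀ {n} → Fin n → Fin n → Bool
a == b = does (a ≟ b)

edges : ∀ {n} → Graph n → List (Edge n)
edges {n} G = concatMap (λ i → concatMap (λ j →
  if (toℕ i <ᵇ toℕ j) ∧ G i j then (i , j) ∷ [] else []) (allFin n)) (allFin n)

subsets : ∀ {A : Set} → List A → List (List A)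
subsets [] = [] ∷ []
subsets (x ∷ xs) = let s = subsets xs in s ++ map (x ∷_) s

step : ∀ {n} → List (Edge n) → (Fin n → Bool) → (Fin n → Bool)
step es R x = R x ∨ any (λ { (a , b) → ((a == x) ∧ R b) ∨ ((b == x) ∧ R a) }) es

iter : ∀ {A : Set} → ℕ → (A → A) → A → A
iter zero f a = a
iter (suc k) f a = f (iter k f a)

-- reachable es u v : v is joined to u by a walk using edges of es
-- (n iterations suffice on n vertices)
reachable : ∀ {n} → List (Edge n) → Fin n → Fin n → Bool
reachable {n} es u = iter n (step es) (λ x → u == x)

connected : ∀ {n} → List (Edge n) → Bool
connected {n} es = all (λ u → all (λ v → reachable es u v) (allFin n)) (allFin n)

picks : ∀ {A : Set} → List A → List (A × List A)
picks [] = []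
picks (x ∷ xs) = (x , xs) ∷ map (λ { (y , ys) → (y , x ∷ ys) }) (picks xs)

-- (V, es) is acyclic: no edge lies on a cycle, i.e. for no edge ab are
-- a and b still joined by a walk after deleting the edge ab
acyclic : ∀ {n} → List (Edge n) → Bool
acyclic es = all (λ { ((a , b) , rest) → not (reachable rest a b) }) (picks es)

isSpanningTree : ∀ {n} → List (Edge n) → Bool
isSpanningTree es = connected es ∧ acyclic es

τ : ∀ {n} → Graph n → ℕ
τ G = length (filterᵇ isSpanningTree (subsets (edges G)))

move : ∀ {n} → Graph n → (v v₁ w : Fin n) → Graph n
move G v v₁ w x y =
  if ((x == v) ∧ (y == v₁)) ∨ ((x == v₁) ∧ (y == v)) then false
  else if ((x == w) ∧ (y == v₁)) ∨ ((x == v₁) ∧ (y == w)) then true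
  else G x y

{-# OPTIONS --safe #-}
module Submission where

-- A spanning tree T of G avoiding vv₁ is kept. Otherwise T − vv₁ has two components: if w lies
-- in the one of v, put wv₁ in place of vv₁; if w lies in the one of v₁ and u is the neighbour of
-- w on its path to v₁, replace vv₁ and wu by vu and wv₁ (vu is an edge of G as N(w) ⊆ N[v]).
-- This injects the spanning trees of G into those of G(v →v₁ w): the image tells the case apart
-- (by wv₁ and by whether v, v₁ stay joined without it) and determines u. It misses every
-- spanning tree containing wv₁, vv₂ and P*, whose preimage would contain vv₁ together with the
-- path v v₂ P* v₁, i.e. a cycle.

open import Defs
open import Data.Bool using (Bool; true; false; _∧_; _∨_; not; if_then_else_; T?)
open import Data.Bool.ListAction using (any; all)
open import Data.Bool.Properties using (∧-conicalˡ; ∧-conicalʳ; not-¬; ¬-not; not-injective; T-≡)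
open import Data.Empty using (⊥; ⊥-elim)
open import Data.Fin using (Fin; toℕ; _≟_)
open import Data.Fin.Properties using (toℕ-injective; any?)
open import Data.List using (List; []; _∷_; length; _++_; allFin; map; concatMap; filterᵇ; head; last)
open import Data.List.Membership.Propositional using (_∈_; find; lose)
open import Data.List.Membership.Propositional.Properties
  using (∈-∃++; ∈-++⁻; ∈-++⁺ˡ; ∈-++⁺ʳ; ∈-allFin; ∈-map⁺; ∈-map⁻; ∈-concatMap⁺; ∈-concatMap⁻;
         ∈-filter⁺; ∈-filter⁻)
open import Data.List.Properties using (length-++-sucʳ; length-tabulate; length-map; filter-accept; filter-reject)
open import Data.List.Relation.Unary.All as All using (All; []; _∷_)
open import Data.List.Relation.Unary.All.Properties using (all⁺; all⁻)
open import Data.List.Relation.Unary.AllPairs using (AllPairs; []; _∷_)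
open import Data.List.Relation.Unary.Any using (here; there)
open import Data.List.Relation.Unary.Any.Properties using (any⁺; any⁻)
open import Data.List.Relation.Unary.Linked using (Linked; []; _∷_)
open import Data.List.Relation.Unary.Unique.Propositional using (Unique)
import Data.List.Relation.Unary.Unique.Propositional.Properties as UP
open import Data.Maybe using (just)
open import Data.Nat using (ℕ; zero; suc; _≤_; _<_; _+_; _∸_; _<ᵇ_; z≤n; s≤s)
open import Data.Nat.Properties using (≤-trans; n≤1+n; m∸n+n≡m; <ᵇ⇒<; <⇒<ᵇ; <-asym; <-cmp)
open import Data.Product using (_×_; _,_; proj₁; proj₂; Σ; ∃)
import Data.Product as Product
open import Data.Sum using (_⊎_; inj₁; inj₂; [_,_]′; map₁)
open import Function using (_∘_)
open import Function.Bundles using (module Equivalence)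
open import Relation.Binary using (tri<; tri≈; tri>)
open import Relation.Binary.PropositionalEquality using (_≡_; _≢_; refl; sym; trans; cong; cong₂; subst)
open import Relation.Nullary using (¬_; yes; no; Dec)
open import Relation.Nullary.Decidable using (_×-dec_)

∧-true : ∀ {a b} → a ≡ true → b ≡ true → a ∧ b ≡ true
∧-true refl refl = refl

∨-true⁻ : ∀ {a b} → a ∨ b ≡ true → a ≡ true ⊎ b ≡ true
∨-true⁻ {true} _ = inj₁ refl
∨-true⁻ {false} e = inj₂ e

∨-trueˡ : ∀ {a b} → a ≡ true → a ∨ b ≡ true
∨-trueˡ refl = refl

∨-trueʳ : ∀ {a b} → b ≡ true → a ∨ b ≡ true
∨-trueʳ {true} _ = refl
∨-trueʳ {false} e = e

≡-from-≡true : ∀ a b → (a ≡ true → b ≡ true) → (b ≡ true → a ≡ true) → a ≡ b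
≡-from-≡true true true _ _ = refl
≡-from-≡true false false _ _ = refl
≡-from-≡true true false f _ = sym (f refl)
≡-from-≡true false true _ g = g refl

Unique-length-≤ : ∀ {A : Set} {xs ys : List A} → Unique xs → (∀ {z} → z ∈ xs → z ∈ ys) → length xs ≤ length ys
Unique-length-≤ {xs = []} _ _ = z≤n
Unique-length-≤ {xs = x ∷ xs} {ys} (x∉xs ∷ u) xs⊆ys with ∈-∃++ (xs⊆ys (here refl))
... | ys₁ , ys₂ , refl =
  subst (suc (length xs) ≤_) (sym (length-++-sucʳ ys₁ x ys₂)) (s≤s (Unique-length-≤ u xs⊆ys₁++ys₂))
  where
  xs⊆ys₁++ys₂ : ∀ {z} → z ∈ xs → z ∈ ys₁ ++ ys₂
  xs⊆ys₁++ys₂ z∈xs with ∈-++⁻ ys₁ (xs⊆ys (there z∈xs))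
  ... | inj₁ h = ∈-++⁺ˡ h
  ... | inj₂ (here refl) = ⊥-elim (All.lookup x∉xs z∈xs refl)
  ... | inj₂ (there h) = ∈-++⁺ʳ ys₁ h

module _ {A : Set} (p : A → Bool) where

  any-true⁻ : ∀ xs → any p xs ≡ true → ∃ λ z → z ∈ xs × p z ≡ true
  any-true⁻ xs e with find (any⁻ p xs (Equivalence.from T-≡ e))
  ... | z , z∈xs , pz = z , z∈xs , Equivalence.to T-≡ pz

  any-true⁺ : ∀ {xs z} → z ∈ xs → p z ≡ true → any p xs ≡ true
  any-true⁺ z∈xs pz = Equivalence.to T-≡ (any⁺ p (lose z∈xs (Equivalence.from T-≡ pz)))

  all-true⁻ : ∀ xs → all p xs ≡ true → ∀ {z} → z ∈ xs → p z ≡ true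
  all-true⁻ xs e z∈xs = Equivalence.to T-≡ (All.lookup (all⁺ p xs (Equivalence.from T-≡ e)) z∈xs)

  all-true⁺ : ∀ xs → (∀ {z} → z ∈ xs → p z ≡ true) → all p xs ≡ true
  all-true⁺ xs h = Equivalence.to T-≡ (all⁻ p (All.tabulate (λ z∈xs → Equivalence.from T-≡ (h z∈xs))))

module _ {X Y : Set} (f : X → Y) where

  Unique-map-on : ∀ {xs} → Unique xs → (∀ {a b} → a ∈ xs → b ∈ xs → f a ≡ f b → a ≡ b) → Unique (map f xs)
  Unique-map-on {[]} _ _ = []
  Unique-map-on {x ∷ xs} (x∉xs ∷ u) inj =
    All.tabulate (λ z∈ → let (a , a∈ , z≡fa) = ∈-map⁻ f z∈ in
                   λ fx≡z → All.lookup x∉xs a∈ (inj (here refl) (there a∈) (trans fx≡z z≡fa)))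
    ∷ Unique-map-on u (λ i j → inj (there i) (there j))

  length-<-injection : ∀ {xs ys} → Unique xs → (∀ {a} → a ∈ xs → f a ∈ ys) →
                       (∀ {a b} → a ∈ xs → b ∈ xs → f a ≡ f b → a ≡ b) →
                       ∀ {y} → y ∈ ys → (∀ {a} → a ∈ xs → f a ≢ y) → length xs < length ys
  length-<-injection {xs} {ys} u into inj {y} y∈ys missed =
    subst (λ k → suc k ≤ length ys) (length-map f xs) (Unique-length-≤ (y∉image ∷ Unique-map-on u inj) image⊆ys)
    where
    y∉image : All (y ≢_) (map f xs)
    y∉image = All.tabulate λ z∈ → let (a , a∈ , z≡fa) = ∈-map⁻ f z∈ in λ y≡z → missed a∈ (sym (trans y≡z z≡fa))
    image⊆ys : ∀ {z} → z ∈ y ∷ map f xs → z ∈ ys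
    image⊆ys (here refl) = y∈ys
    image⊆ys (there z∈) = let (a , a∈ , z≡fa) = ∈-map⁻ f z∈ in subst (_∈ ys) (sym z≡fa) (into a∈)

module _ {A B : Set} (f : A → List B) where

  ∈-concatMap-∃ : ∀ xs {y} → y ∈ concatMap f xs → ∃ λ x → x ∈ xs × y ∈ f x
  ∈-concatMap-∃ xs y∈ = find (∈-concatMap⁻ f {xs = xs} y∈)

  ∈-concatMap-∈ : ∀ {xs x y} → x ∈ xs → y ∈ f x → y ∈ concatMap f xs
  ∈-concatMap-∈ x∈ y∈ = ∈-concatMap⁺ f (lose x∈ y∈)

  Unique-concatMap : ∀ {xs} → Unique xs → (∀ x → Unique (f x)) →
                     (∀ x x′ {y} → y ∈ f x → y ∈ f x′ → x ≡ x′) → Unique (concatMap f xs)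
  Unique-concatMap {[]} _ _ _ = []
  Unique-concatMap {x ∷ xs} (x∉xs ∷ u) uf disjoint =
    UP.++⁺ (uf x) (Unique-concatMap u uf disjoint) λ (y∈fx , y∈rest) →
      let (x′ , x′∈xs , y∈fx′) = ∈-concatMap-∃ xs y∈rest in All.lookup x∉xs x′∈xs (disjoint x x′ y∈fx y∈fx′)

module _ {A : Set} where

  ∈-if⁻ : ∀ (b : Bool) {z y : A} → y ∈ (if b then z ∷ [] else []) → b ≡ true × y ≡ z
  ∈-if⁻ true (here refl) = refl , refl

  ∈-if⁺ : ∀ {b : Bool} {z : A} → b ≡ true → z ∈ (if b then z ∷ [] else [])
  ∈-if⁺ refl = here refl

  Unique-if : ∀ (b : Bool) {z : A} → Unique (if b then z ∷ [] else [])
  Unique-if true = [] ∷ []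
  Unique-if false = []

  filterᵇ-accept : ∀ (p : A → Bool) {x xs} → p x ≡ true → filterᵇ p (x ∷ xs) ≡ x ∷ filterᵇ p xs
  filterᵇ-accept p e = filter-accept (T? ∘ p) (Equivalence.from T-≡ e)

  filterᵇ-reject : ∀ (p : A → Bool) {x xs} → p x ≡ false → filterᵇ p (x ∷ xs) ≡ filterᵇ p xs
  filterᵇ-reject p e = filter-reject (T? ∘ p) (λ t → not-¬ (Equivalence.to T-≡ t) e)

  ∈-filterᵇ⁻ : ∀ (p : A → Bool) {xs z} → z ∈ filterᵇ p xs → z ∈ xs × p z ≡ true
  ∈-filterᵇ⁻ p z∈ = let (i , t) = ∈-filter⁻ (T? ∘ p) z∈ in i , Equivalence.to T-≡ t

  ∈-filterᵇ⁺ : ∀ (p : A → Bool) {xs z} → z ∈ xs → p z ≡ true → z ∈ filterᵇ p xs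
  ∈-filterᵇ⁺ p i e = ∈-filter⁺ (T? ∘ p) i (Equivalence.from T-≡ e)

  filterᵇ-cong : ∀ (p q : A → Bool) xs → (∀ {z} → z ∈ xs → p z ≡ q z) → filterᵇ p xs ≡ filterᵇ q xs
  filterᵇ-cong p q [] _ = refl
  filterᵇ-cong p q (x ∷ xs) h with p x in px
  ... | true = trans (cong (x ∷_) (filterᵇ-cong p q xs (λ i → h (there i))))
                     (sym (filterᵇ-accept q (trans (sym (h (here refl))) px)))
  ... | false = trans (filterᵇ-cong p q xs (λ i → h (there i)))
                      (sym (filterᵇ-reject q (trans (sym (h (here refl))) px)))

  subsets-⊆ : ∀ {L T : List A} → T ∈ subsets L → ∀ {z} → z ∈ T → z ∈ L
  subsets-⊆ {[]} (here refl) ()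
  subsets-⊆ {x ∷ xs} i z∈T with ∈-++⁻ (subsets xs) i
  ... | inj₁ j = there (subsets-⊆ j z∈T)
  ... | inj₂ j with ∈-map⁻ (x ∷_) j
  ... | T′ , j′ , refl with z∈T
  ... | here refl = here refl
  ... | there z∈T′ = there (subsets-⊆ j′ z∈T′)

  filterᵇ-∈-subsets : ∀ (p : A → Bool) L → filterᵇ p L ∈ subsets L
  filterᵇ-∈-subsets p [] = here refl
  filterᵇ-∈-subsets p (x ∷ xs) with p x
  ... | true = ∈-++⁺ʳ (subsets xs) (∈-map⁺ (x ∷_) (filterᵇ-∈-subsets p xs))
  ... | false = ∈-++⁺ˡ (filterᵇ-∈-subsets p xs)

  Unique-subsets : ∀ {L : List A} → Unique L → Unique (subsets L)
  Unique-subsets {[]} _ = [] ∷ []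
  Unique-subsets {x ∷ xs} (x∉xs ∷ u) =
    UP.++⁺ (Unique-subsets u) (UP.map⁺ (λ { refl → refl }) (Unique-subsets u)) λ (i₁ , i₂) →
      let (T′ , _ , e) = ∈-map⁻ (x ∷_) i₂ in All.lookup x∉xs (subsets-⊆ i₁ (subst (x ∈_) (sym e) (here refl))) refl

  Unique-∈-subsets : ∀ {L T : List A} → T ∈ subsets L → Unique L → Unique T
  Unique-∈-subsets {[]} (here refl) _ = []
  Unique-∈-subsets {x ∷ xs} i (x∉xs ∷ u) with ∈-++⁻ (subsets xs) i
  ... | inj₁ j = Unique-∈-subsets j u
  ... | inj₂ j with ∈-map⁻ (x ∷_) j
  ... | T′ , j′ , refl =
        All.tabulate (λ z∈T′ x≡z → All.lookup x∉xs (subsets-⊆ j′ z∈T′) x≡z) ∷ Unique-∈-subsets j′ u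

  subset-as-filterᵇ : ∀ {L T : List A} → T ∈ subsets L → Unique L → (p : A → Bool) →
                      (∀ {z} → z ∈ L → (p z ≡ true → z ∈ T) × (z ∈ T → p z ≡ true)) → T ≡ filterᵇ p L
  subset-as-filterᵇ {[]} (here refl) _ _ _ = refl
  subset-as-filterᵇ {x ∷ xs} i (x∉xs ∷ u) p mem with ∈-++⁻ (subsets xs) i
  ... | inj₁ j = trans (subset-as-filterᵇ j u p (λ z∈ → mem (there z∈)))
                       (sym (filterᵇ-reject p (¬-not λ px → All.lookup x∉xs (subsets-⊆ j (proj₁ (mem (here refl)) px)) refl)))
  ... | inj₂ j with ∈-map⁻ (x ∷_) j
  ... | T′ , j′ , refl = trans (cong (x ∷_) (subset-as-filterᵇ j′ u p mem′))
                               (sym (filterᵇ-accept p (proj₂ (mem (here refl)) (here refl))))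
    where
    mem′ : ∀ {z} → z ∈ xs → (p z ≡ true → z ∈ T′) × (z ∈ T′ → p z ≡ true)
    mem′ {z} z∈xs = (λ pz → drop-x (proj₁ (mem (there z∈xs)) pz)) ,
                    (λ z∈T′ → proj₂ (mem (there z∈xs)) (there z∈T′))
      where
      drop-x : z ∈ x ∷ T′ → z ∈ T′
      drop-x (here refl) = ⊥-elim (All.lookup x∉xs z∈xs refl)
      drop-x (there z∈T′) = z∈T′

  picks⁻ : ∀ (L : List A) {e rest} → (e , rest) ∈ picks L →
           ∃ λ xs → ∃ λ ys → L ≡ xs ++ e ∷ ys × rest ≡ xs ++ ys
  picks⁻ (x ∷ xs) (here refl) = [] , xs , refl , refl
  picks⁻ (x ∷ xs) (there i) with ∈-map⁻ (λ { (y , ys) → (y , x ∷ ys) }) i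
  ... | (y , ys) , j , refl with picks⁻ xs j
  ... | as , bs , refl , refl = x ∷ as , bs , refl , refl

  picks⁺ : ∀ (L : List A) {e} → e ∈ L → ∃ λ rest → (e , rest) ∈ picks L
  picks⁺ (x ∷ xs) (here refl) = xs , here refl
  picks⁺ (x ∷ xs) (there i) with picks⁺ xs i
  ... | rest , j = x ∷ rest , there (∈-map⁺ (λ { (y , ys) → (y , x ∷ ys) }) j)

  ∈-++-∷⁺ : ∀ xs {e : A} {ys z} → z ∈ xs ++ ys → z ∈ xs ++ e ∷ ys
  ∈-++-∷⁺ xs i with ∈-++⁻ xs i
  ... | inj₁ j = ∈-++⁺ˡ j
  ... | inj₂ j = ∈-++⁺ʳ xs (there j)

  ∈-++-∷⁻ : ∀ xs {e : A} {ys z} → z ∈ xs ++ e ∷ ys → z ≢ e → z ∈ xs ++ ys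
  ∈-++-∷⁻ xs i z≢e with ∈-++⁻ xs i
  ... | inj₁ j = ∈-++⁺ˡ j
  ... | inj₂ (here refl) = ⊥-elim (z≢e refl)
  ... | inj₂ (there j) = ∈-++⁺ʳ xs j

  Unique-++-∷ : ∀ xs {e : A} {ys z} → Unique (xs ++ e ∷ ys) → z ∈ xs ++ ys → z ≢ e
  Unique-++-∷ [] (e∉ys ∷ _) i refl = All.lookup e∉ys i refl
  Unique-++-∷ (x ∷ xs) (x∉ ∷ _) (here refl) refl = All.lookup x∉ (∈-++⁺ʳ xs (here refl)) refl
  Unique-++-∷ (x ∷ xs) (_ ∷ u) (there i) = Unique-++-∷ xs u i

-- Graphs, walks and single-edge changes

module _ {n : ℕ} where

  ==-sound : {a b : Fin n} → a == b ≡ true → a ≡ b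
  ==-sound {a} {b} e with a ≟ b
  ... | yes p = p

  ==-refl : (a : Fin n) → a == a ≡ true
  ==-refl a with a ≟ a
  ... | yes _ = refl
  ... | no q = ⊥-elim (q refl)

  ==-false : {a b : Fin n} → a ≢ b → a == b ≡ false
  ==-false {a} {b} q with a ≟ b
  ... | yes p = ⊥-elim (q p)
  ... | no _ = refl

  data SameEdge (a b x y : Fin n) : Set where
    straight : x ≡ a → y ≡ b → SameEdge a b x y
    crossed  : x ≡ b → y ≡ a → SameEdge a b x y

  SameEdge-flip : ∀ {a b x y} → SameEdge a b x y → SameEdge a b y x
  SameEdge-flip (straight p q) = crossed q p
  SameEdge-flip (crossed p q) = straight q p

  SameEdge-comm : ∀ {a b x y} → SameEdge a b x y → SameEdge b a x y
  SameEdge-comm (straight p q) = crossed p q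
  SameEdge-comm (crossed p q) = straight p q

  SameEdge-sym : ∀ {a b x y} → SameEdge a b x y → SameEdge x y a b
  SameEdge-sym (straight refl refl) = straight refl refl
  SameEdge-sym (crossed refl refl) = crossed refl refl

  SameEdge-trans : ∀ {a b p q x y} → SameEdge a b p q → SameEdge a b x y → SameEdge p q x y
  SameEdge-trans (straight refl refl) (straight refl refl) = straight refl refl
  SameEdge-trans (straight refl refl) (crossed refl refl) = crossed refl refl
  SameEdge-trans (crossed refl refl) (straight refl refl) = crossed refl refl
  SameEdge-trans (crossed refl refl) (crossed refl refl) = straight refl refl

  sameEdgeᵇ : Fin n → Fin n → Fin n → Fin n → Bool
  sameEdgeᵇ a b x y = ((x == a) ∧ (y == b)) ∨ ((x == b) ∧ (y == a))

  sameEdgeᵇ-sound : ∀ a b x y → sameEdgeᵇ a b x y ≡ true → SameEdge a b x y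
  sameEdgeᵇ-sound a b x y e with ∨-true⁻ {(x == a) ∧ (y == b)} e
  ... | inj₁ h = straight (==-sound (∧-conicalˡ _ _ h)) (==-sound (∧-conicalʳ _ _ h))
  ... | inj₂ h = crossed (==-sound (∧-conicalˡ _ _ h)) (==-sound (∧-conicalʳ _ _ h))

  sameEdgeᵇ-complete : ∀ {a b x y} → SameEdge a b x y → sameEdgeᵇ a b x y ≡ true
  sameEdgeᵇ-complete {a} {b} (straight refl refl) = ∨-trueˡ (∧-true (==-refl a) (==-refl b))
  sameEdgeᵇ-complete {a} {b} (crossed refl refl) = ∨-trueʳ {(b == a) ∧ (a == b)} (∧-true (==-refl b) (==-refl a))

  sameEdgeᵇ-false : ∀ {a b x y} → ¬ SameEdge a b x y → sameEdgeᵇ a b x y ≡ false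
  sameEdgeᵇ-false {a} {b} {x} {y} h = ¬-not (λ e → h (sameEdgeᵇ-sound a b x y e))

  sameEdge? : ∀ a b x y → Dec (SameEdge a b x y)
  sameEdge? a b x y with sameEdgeᵇ a b x y in e
  ... | true = yes (sameEdgeᵇ-sound a b x y e)
  ... | false = no (λ p → not-¬ (sameEdgeᵇ-complete p) e)

  sameEdgeᵇ-flip : ∀ a b x y → sameEdgeᵇ a b x y ≡ sameEdgeᵇ a b y x
  sameEdgeᵇ-flip a b x y = ≡-from-≡true _ _
    (λ e → sameEdgeᵇ-complete (SameEdge-flip (sameEdgeᵇ-sound a b x y e)))
    (λ e → sameEdgeᵇ-complete (SameEdge-flip (sameEdgeᵇ-sound a b y x e)))

  -- The graphs E built below need not be symmetric relations; Adj reads their edges unoriented.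
  data Adj (E : Graph n) (x y : Fin n) : Set where
    fwd : E x y ≡ true → Adj E x y
    bwd : E y x ≡ true → Adj E x y

  adj-sym : ∀ {E x y} → Adj E x y → Adj E y x
  adj-sym (fwd e) = bwd e
  adj-sym (bwd e) = fwd e

  adj? : ∀ (E : Graph n) x y → Dec (Adj E x y)
  adj? E x y with E x y in e₁ | E y x in e₂
  ... | true | _ = yes (fwd e₁)
  ... | false | true = yes (bwd e₂)
  ... | false | false = no λ { (fwd h) → not-¬ h e₁ ; (bwd h) → not-¬ h e₂ }

  adj-sameEdge : ∀ {E a b x y} → Adj E a b → SameEdge a b x y → Adj E x y
  adj-sameEdge ab (straight refl refl) = ab
  adj-sameEdge ab (crossed refl refl) = adj-sym ab

  data Walk (E : Graph n) : Fin n → Fin n → Set where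
    nil : ∀ {x} → Walk E x x
    cons : ∀ {x y z} → Adj E x y → Walk E y z → Walk E x z

  infixr 5 _++ʷ_
  _++ʷ_ : ∀ {E x y z} → Walk E x y → Walk E y z → Walk E x z
  nil ++ʷ q = q
  cons a p ++ʷ q = cons a (p ++ʷ q)

  [_]ʷ : ∀ {E x y} → Adj E x y → Walk E x y
  [ a ]ʷ = cons a nil

  reverseʷ : ∀ {E x y} → Walk E x y → Walk E y x
  reverseʷ nil = nil
  reverseʷ (cons a p) = reverseʷ p ++ʷ [ adj-sym a ]ʷ

  Connected : Graph n → Set
  Connected E = ∀ x y → Walk E x y

  walk-from-isolated : ∀ {E x z} → (∀ y → ¬ Adj E x y) → Walk E x z → x ≡ z
  walk-from-isolated _ nil = refl
  walk-from-isolated h (cons {y = y} a _) = ⊥-elim (h y a)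

  infix 4 _⊑_ _≈_
  _⊑_ : Graph n → Graph n → Set
  E ⊑ F = ∀ x y → E x y ≡ true → Adj F x y

  _≈_ : Graph n → Graph n → Set
  E ≈ F = E ⊑ F × F ⊑ E

  ⊑-refl : ∀ {E} → E ⊑ E
  ⊑-refl _ _ e = fwd e

  adj-mono : ∀ {E F x y} → E ⊑ F → Adj E x y → Adj F x y
  adj-mono {x = x} {y} s (fwd e) = s x y e
  adj-mono {x = x} {y} s (bwd e) = adj-sym (s y x e)

  ⊑-trans : ∀ {E F H} → E ⊑ F → F ⊑ H → E ⊑ H
  ⊑-trans s t x y e = adj-mono t (s x y e)

  ≈-sym : ∀ {E F} → E ≈ F → F ≈ E
  ≈-sym (s , t) = t , s

  ≈-trans : ∀ {E F H} → E ≈ F → F ≈ H → E ≈ H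
  ≈-trans (s , t) (s′ , t′) = ⊑-trans s s′ , ⊑-trans t′ t

  walk-mono : ∀ {E F x y} → E ⊑ F → Walk E x y → Walk F x y
  walk-mono s nil = nil
  walk-mono s (cons a p) = cons (adj-mono s a) (walk-mono s p)

  walk-lift : ∀ {E F x y} → (∀ a b → E a b ≡ true → Walk F a b) → Walk E x y → Walk F x y
  walk-lift h nil = nil
  walk-lift {x = x} h (cons {y = y} (fwd e) p) = h x y e ++ʷ walk-lift h p
  walk-lift {x = x} h (cons {y = y} (bwd e) p) = reverseʷ (h y x e) ++ʷ walk-lift h p

  _∖[_,_] : Graph n → Fin n → Fin n → Graph n
  (E ∖[ a , b ]) x y = E x y ∧ not (sameEdgeᵇ a b x y)

  _+[_,_] : Graph n → Fin n → Fin n → Graph n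
  (E +[ a , b ]) x y = E x y ∨ sameEdgeᵇ a b x y

  module _ {E : Graph n} {a b : Fin n} where

    ∖-true⁻ : ∀ {x y} → (E ∖[ a , b ]) x y ≡ true → E x y ≡ true × ¬ SameEdge a b x y
    ∖-true⁻ e = ∧-conicalˡ _ _ e ,
                λ p → not-¬ (sameEdgeᵇ-complete p) (not-injective (∧-conicalʳ _ _ e))

    ∖-true⁺ : ∀ {x y} → E x y ≡ true → ¬ SameEdge a b x y → (E ∖[ a , b ]) x y ≡ true
    ∖-true⁺ e np = ∧-true e (cong not (sameEdgeᵇ-false np))

    adj-∖⁻ : ∀ {x y} → Adj (E ∖[ a , b ]) x y → Adj E x y × ¬ SameEdge a b x y
    adj-∖⁻ (fwd e) = let (h , np) = ∖-true⁻ e in fwd h , np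
    adj-∖⁻ (bwd e) = let (h , np) = ∖-true⁻ e in bwd h , λ p → np (SameEdge-flip p)

    adj-∖⁺ : ∀ {x y} → Adj E x y → ¬ SameEdge a b x y → Adj (E ∖[ a , b ]) x y
    adj-∖⁺ (fwd e) np = fwd (∖-true⁺ e np)
    adj-∖⁺ (bwd e) np = bwd (∖-true⁺ e (λ p → np (SameEdge-flip p)))

    adj-+⁻ : ∀ {x y} → Adj (E +[ a , b ]) x y → Adj E x y ⊎ SameEdge a b x y
    adj-+⁻ {x} {y} (fwd e) with ∨-true⁻ {E x y} e
    ... | inj₁ h = inj₁ (fwd h)
    ... | inj₂ h = inj₂ (sameEdgeᵇ-sound a b x y h)
    adj-+⁻ {x} {y} (bwd e) with ∨-true⁻ {E y x} e
    ... | inj₁ h = inj₁ (bwd h)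
    ... | inj₂ h = inj₂ (SameEdge-flip (sameEdgeᵇ-sound a b y x h))

    adj-+⁺ : ∀ {x y} → Adj E x y → Adj (E +[ a , b ]) x y
    adj-+⁺ (fwd e) = fwd (∨-trueˡ e)
    adj-+⁺ (bwd e) = bwd (∨-trueˡ e)

    adj-+-new : ∀ {x y} → SameEdge a b x y → Adj (E +[ a , b ]) x y
    adj-+-new {x} {y} p = fwd (∨-trueʳ {E x y} (sameEdgeᵇ-complete p))

    ∖-⊑ : (E ∖[ a , b ]) ⊑ E
    ∖-⊑ _ _ e = fwd (proj₁ (∖-true⁻ e))

    ⊑-+ : E ⊑ (E +[ a , b ])
    ⊑-+ _ _ e = fwd (∨-trueˡ e)

    +-⊑ : ∀ {F} → E ⊑ F → Adj F a b → (E +[ a , b ]) ⊑ F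
    +-⊑ s ab x y e with adj-+⁻ (fwd e)
    ... | inj₁ h = adj-mono s h
    ... | inj₂ p = adj-sameEdge ab p

  ⊑-∖+ : ∀ {E a b} → E ⊑ ((E ∖[ a , b ]) +[ a , b ])
  ⊑-∖+ {E} {a} {b} x y e with sameEdge? a b x y
  ... | yes p = adj-+-new {E = E ∖[ a , b ]} p
  ... | no np = adj-+⁺ {E = E ∖[ a , b ]} (fwd (∖-true⁺ {E} e np))

  ∖-mono : ∀ {E F a b} → E ⊑ F → (E ∖[ a , b ]) ⊑ (F ∖[ a , b ])
  ∖-mono {E} {F} s x y e = let (h , np) = ∖-true⁻ {E} e in adj-∖⁺ {F} (s x y h) np

  +∖-⊑ : ∀ {E a b} → ((E +[ a , b ]) ∖[ a , b ]) ⊑ E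
  +∖-⊑ {E} x y e with adj-∖⁻ {E +[ _ , _ ]} (fwd e)
  ... | h , np with adj-+⁻ {E} h
  ... | inj₁ exy = exy
  ... | inj₂ p = ⊥-elim (np p)

  ∖-≈ : ∀ {E F a b} → E ≈ F → (E ∖[ a , b ]) ≈ (F ∖[ a , b ])
  ∖-≈ (s , t) = ∖-mono s , ∖-mono t

  -- Forests and trees

  walk-+-split : ∀ {E c d x y} → Walk (E +[ c , d ]) x y →
                 Walk E x y ⊎ (Walk E x c × Walk E d y) ⊎ (Walk E x d × Walk E c y)
  walk-+-split nil = inj₁ nil
  walk-+-split {E} (cons a p) with adj-+⁻ {E} a | walk-+-split p
  ... | inj₁ e | inj₁ q = inj₁ (cons e q)
  ... | inj₁ e | inj₂ (inj₁ (q , r)) = inj₂ (inj₁ (cons e q , r))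
  ... | inj₁ e | inj₂ (inj₂ (q , r)) = inj₂ (inj₂ (cons e q , r))
  ... | inj₂ (straight refl refl) | inj₁ q = inj₂ (inj₁ (nil , q))
  ... | inj₂ (straight refl refl) | inj₂ (inj₁ (_ , r)) = inj₂ (inj₁ (nil , r))
  ... | inj₂ (straight refl refl) | inj₂ (inj₂ (_ , r)) = inj₁ r
  ... | inj₂ (crossed refl refl) | inj₁ q = inj₂ (inj₂ (nil , q))
  ... | inj₂ (crossed refl refl) | inj₂ (inj₁ (_ , r)) = inj₁ r
  ... | inj₂ (crossed refl refl) | inj₂ (inj₂ (_ , r)) = inj₂ (inj₂ (nil , r))

  walk-+-replace : ∀ {E F a b x y} → E ⊑ F → Walk F a b → Walk (E +[ a , b ]) x y → Walk F x y
  walk-+-replace s ab nil = nil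
  walk-+-replace {E} s ab (cons e p) with adj-+⁻ {E} e
  ... | inj₁ h = cons (adj-mono s h) (walk-+-replace s ab p)
  ... | inj₂ (straight refl refl) = ab ++ʷ walk-+-replace s ab p
  ... | inj₂ (crossed refl refl) = reverseʷ ab ++ʷ walk-+-replace s ab p

  Forest : Graph n → Set
  Forest E = ∀ p q → E p q ≡ true → ¬ Walk (E ∖[ p , q ]) p q

  Tree : Graph n → Set
  Tree E = Connected E × Forest E

  ∖-comm : ∀ {E p q} → (E ∖[ p , q ]) ⊑ (E ∖[ q , p ])
  ∖-comm {E} _ _ e = let (h , np) = ∖-true⁻ {E} e in fwd (∖-true⁺ {E} h (λ s → np (SameEdge-comm s)))

  forest-acyclic : ∀ {E p q} → Forest E → Adj E p q → ¬ Walk (E ∖[ p , q ]) p q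
  forest-acyclic {p = p} {q} f (fwd e) c = f p q e c
  forest-acyclic {E} {p = p} {q} f (bwd e) c = f q p e (reverseʷ (walk-mono (∖-comm {E}) c))

  forest-antimono : ∀ {E F} → E ⊑ F → Forest F → Forest E
  forest-antimono s f p q e c = forest-acyclic f (s p q e) (walk-mono (∖-mono s) c)

  forest-+ : ∀ {F c d} → Forest F → ¬ Walk F c d → Forest (F +[ c , d ])
  forest-+ {F} {c} {d} f ¬cd p q e cyc with ∨-true⁻ {F p q} e
  ... | inj₂ pq = ¬cd (as-cd (sameEdgeᵇ-sound c d p q pq))
    where
    rest⊑F : SameEdge c d p q → ((F +[ c , d ]) ∖[ p , q ]) ⊑ F
    rest⊑F cd-pq x y e′ with adj-∖⁻ {F +[ c , d ]} (fwd e′)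
    ... | h , np with adj-+⁻ {F} h
    ... | inj₁ fxy = fxy
    ... | inj₂ cd-xy = ⊥-elim (np (SameEdge-trans cd-pq cd-xy))
    as-cd : SameEdge c d p q → Walk F c d
    as-cd s@(straight refl refl) = walk-mono (rest⊑F s) cyc
    as-cd s@(crossed refl refl) = reverseʷ (walk-mono (rest⊑F s) cyc)
  ... | inj₁ fpq with walk-+-split (walk-mono rest⊑ cyc)
    where
    rest⊑ : ((F +[ c , d ]) ∖[ p , q ]) ⊑ ((F ∖[ p , q ]) +[ c , d ])
    rest⊑ x y e′ with adj-∖⁻ {F +[ c , d ]} (fwd e′)
    ... | h , np with adj-+⁻ {F} h
    ... | inj₁ fxy = adj-+⁺ {F ∖[ p , q ]} (adj-∖⁺ {F} fxy np)
    ... | inj₂ cd-xy = adj-+-new {F ∖[ p , q ]} cd-xy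
  ... | inj₁ pq = f p q fpq pq
  ... | inj₂ (inj₁ (pc , dq)) =
        ¬cd (walk-mono (∖-⊑ {F}) (reverseʷ pc) ++ʷ [ fwd fpq ]ʷ ++ʷ walk-mono (∖-⊑ {F}) (reverseʷ dq))
  ... | inj₂ (inj₂ (pd , cq)) =
        ¬cd (walk-mono (∖-⊑ {F}) cq ++ʷ [ bwd fpq ]ʷ ++ʷ walk-mono (∖-⊑ {F}) pd)

  tree-exchange : ∀ {E a b c d} → Tree E → Adj E a b →
                  Walk (E ∖[ a , b ]) c a → Walk (E ∖[ a , b ]) d b → Tree ((E ∖[ a , b ]) +[ c , d ])
  tree-exchange {E} {a} {b} {c} {d} (conn , forest) ab ca db = conn′ , forest′
    where
    F : Graph n
    F = E ∖[ a , b ]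
    ¬cd : ¬ Walk F c d
    ¬cd cd = forest-acyclic forest ab (reverseʷ ca ++ʷ cd ++ʷ db)
    forest′ : Forest (F +[ c , d ])
    forest′ = forest-+ (forest-antimono (∖-⊑ {E}) forest) ¬cd
    ab′ : Walk (F +[ c , d ]) a b
    ab′ = walk-mono (⊑-+ {F}) (reverseʷ ca) ++ʷ [ adj-+-new {F} (straight refl refl) ]ʷ ++ʷ walk-mono (⊑-+ {F}) db
    conn′ : Connected (F +[ c , d ])
    conn′ x y = walk-+-replace (⊑-+ {F}) ab′ (walk-mono (⊑-∖+ {E}) (conn x y))

  forest-first-step-unique : ∀ {F v u₁ u₂ t} → Forest F → Adj F v u₁ → Adj F v u₂ →
                             Walk (F ∖[ v , u₁ ]) u₁ t → Walk (F ∖[ v , u₂ ]) u₂ t → u₁ ≡ u₂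
  forest-first-step-unique {F} {v} {u₁} {u₂} forest vu₁ vu₂ u₁t u₂t with u₁ ≟ u₂
  ... | yes u₁≡u₂ = u₁≡u₂
  ... | no u₁≢u₂ with walk-+-split {F ∖[ v , u₁ ] ∖[ v , u₂ ]} (walk-mono (⊑-∖+ {F ∖[ v , u₁ ]}) u₁t)
  ... | inj₁ u₁t′ = ⊥-elim (forest-acyclic forest vu₂ (cons vu₁′ (walk-mono F₁₂⊑F₂ u₁t′ ++ʷ reverseʷ u₂t)))
    where
    vu₁′ : Adj (F ∖[ v , u₂ ]) v u₁
    vu₁′ = adj-∖⁺ {F} vu₁ λ { (straight _ u₁≡u₂) → u₁≢u₂ u₁≡u₂
                           ; (crossed v≡u₂ u₁≡v) → u₁≢u₂ (trans u₁≡v v≡u₂) }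
    F₁₂⊑F₂ : (F ∖[ v , u₁ ] ∖[ v , u₂ ]) ⊑ (F ∖[ v , u₂ ])
    F₁₂⊑F₂ = ∖-mono (∖-⊑ {F})
  ... | inj₂ (inj₁ (u₁v , _)) = ⊥-elim (forest-acyclic forest vu₁ (reverseʷ (walk-mono (∖-⊑ {F ∖[ v , u₁ ]}) u₁v)))
  ... | inj₂ (inj₂ (_ , vt)) = ⊥-elim (forest-acyclic forest vu₂ (walk-mono (∖-mono (∖-⊑ {F})) vt ++ʷ reverseʷ u₂t))

  _∖ᵛ_ : Graph n → Fin n → Graph n
  (E ∖ᵛ a) x y = E x y ∧ (not (x == a) ∧ not (y == a))

  module _ {E : Graph n} {a : Fin n} where

    ∖ᵛ-true⁻ : ∀ {x y} → (E ∖ᵛ a) x y ≡ true → E x y ≡ true × x ≢ a × y ≢ a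
    ∖ᵛ-true⁻ {x} {y} e = ∧-conicalˡ _ _ e , avoids (∧-conicalˡ _ _ side) , avoids (∧-conicalʳ _ _ side)
      where
      side : not (x == a) ∧ not (y == a) ≡ true
      side = ∧-conicalʳ (E x y) _ e
      avoids : ∀ {z} → not (z == a) ≡ true → z ≢ a
      avoids h refl = not-¬ (==-refl a) (not-injective h)

    adj-∖ᵛ⁻ : ∀ {x y} → Adj (E ∖ᵛ a) x y → Adj E x y × x ≢ a × y ≢ a
    adj-∖ᵛ⁻ (fwd e) = let (h , xa , ya) = ∖ᵛ-true⁻ e in fwd h , xa , ya
    adj-∖ᵛ⁻ (bwd e) = let (h , ya , xa) = ∖ᵛ-true⁻ e in bwd h , xa , ya

    adj-∖ᵛ⁺ : ∀ {x y} → Adj E x y → x ≢ a → y ≢ a → Adj (E ∖ᵛ a) x y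
    adj-∖ᵛ⁺ (fwd e) xa ya = fwd (∧-true e (∧-true (cong not (==-false xa)) (cong not (==-false ya))))
    adj-∖ᵛ⁺ (bwd e) xa ya = bwd (∧-true e (∧-true (cong not (==-false ya)) (cong not (==-false xa))))

    ∖ᵛ-⊑-∖ : ∀ {u} → (E ∖ᵛ a) ⊑ (E ∖[ a , u ])
    ∖ᵛ-⊑-∖ x y e with adj-∖ᵛ⁻ (fwd e)
    ... | h , xa , ya = adj-∖⁺ {E} h λ { (straight p _) → xa p ; (crossed _ q) → ya q }

    walk-∖ᵛ-from : ∀ {z} → Walk (E ∖ᵛ a) a z → a ≡ z
    walk-∖ᵛ-from = walk-from-isolated (λ _ h → proj₁ (proj₂ (adj-∖ᵛ⁻ h)) refl)

    walk-after-last-visit : ∀ {x b} → a ≢ b → Walk E x b →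
                            Walk (E ∖ᵛ a) x b ⊎ ∃ λ u → Adj E a u × Walk (E ∖ᵛ a) u b
    walk-after-last-visit _ nil = inj₁ nil
    walk-after-last-visit {x} a≢b (cons {y = y} xy p) with walk-after-last-visit a≢b p
    ... | inj₂ r = inj₂ r
    ... | inj₁ p′ with x ≟ a | y ≟ a
    ... | yes refl | _ = inj₂ (y , xy , p′)
    ... | no _ | yes refl = ⊥-elim (a≢b (walk-∖ᵛ-from p′))
    ... | no x≢a | no y≢a = inj₁ (cons (adj-∖ᵛ⁺ xy x≢a y≢a) p′)

    last-exit : ∀ {b} → a ≢ b → Walk E a b → ∃ λ u → Adj E a u × Walk (E ∖[ a , u ]) u b
    last-exit a≢b p with walk-after-last-visit a≢b p
    ... | inj₁ p′ = ⊥-elim (a≢b (walk-∖ᵛ-from p′))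
    ... | inj₂ (u , au , q) = u , au , walk-mono ∖ᵛ-⊑-∖ q

  -- Reachability by iteration

  open import Data.List.Membership.DecPropositional (_≟_ {n}) using (_∈?_)

  vertices : ∀ {E x y} → Walk E x y → List (Fin n)
  vertices {x = x} nil = x ∷ []
  vertices {x = x} (cons _ p) = x ∷ vertices p

  walk-length : ∀ {E x y} → Walk E x y → ℕ
  walk-length nil = 0
  walk-length (cons _ p) = suc (walk-length p)

  length-vertices : ∀ {E x y} (p : Walk E x y) → length (vertices p) ≡ suc (walk-length p)
  length-vertices nil = refl
  length-vertices (cons _ p) = cong suc (length-vertices p)

  walk-suffix : ∀ {E x y z} (p : Walk E y z) → x ∈ vertices p →
                Σ (Walk E x z) λ q → Unique (vertices p) → Unique (vertices q)
  walk-suffix nil (here refl) = nil , λ u → u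
  walk-suffix (cons a p) (here refl) = cons a p , λ u → u
  walk-suffix (cons a p) (there i) with walk-suffix p i
  ... | q , f = q , λ { (_ ∷ u) → f u }

  walk-to-path : ∀ {E x y} → Walk E x y → Σ (Walk E x y) λ p → Unique (vertices p)
  walk-to-path nil = nil , [] ∷ []
  walk-to-path {x = x} (cons a p) with walk-to-path p
  ... | q , u with x ∈? vertices q
  ... | yes i = let (r , f) = walk-suffix q i in r , f u
  ... | no x∉q = cons a q , All.tabulate (λ i x≡z → x∉q (subst (_∈ vertices q) (sym x≡z) i)) ∷ u

  short-walk : ∀ {E x y} → Walk E x y → Σ (Walk E x y) λ p → walk-length p < n
  short-walk p with walk-to-path p
  ... | q , u = q , subst (_≤ n) (length-vertices q)
                      (subst (length (vertices q) ≤_) (length-tabulate (λ i → i))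
                        (Unique-length-≤ u (λ {z} _ → ∈-allFin z)))

  ExpandsAlong : Graph n → ((Fin n → Bool) → (Fin n → Bool)) → Set
  ExpandsAlong E s = ∀ R x → (s R x ≡ true → R x ≡ true ⊎ ∃ λ y → Adj E x y × R y ≡ true)
                           × (R x ≡ true ⊎ (∃ λ y → Adj E x y × R y ≡ true) → s R x ≡ true)

  module Iteration (E : Graph n) (s : (Fin n → Bool) → (Fin n → Bool)) (expands : ExpandsAlong E s) where

    iter-sound : ∀ k u x → iter k s (u ==_) x ≡ true → Walk E u x
    iter-sound zero u x e with ==-sound {u} {x} e
    ... | refl = nil
    iter-sound (suc k) u x e with proj₁ (expands (iter k s (u ==_)) x) e
    ... | inj₁ h = iter-sound k u x h
    ... | inj₂ (y , xy , h) = iter-sound k u y h ++ʷ [ adj-sym xy ]ʷ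

    private
      iter-shift : ∀ k R → iter k s (s R) ≡ s (iter k s R)
      iter-shift zero R = refl
      iter-shift (suc k) R = cong s (iter-shift k R)

      iter-walk : ∀ {x z} (p : Walk E x z) R → R x ≡ true → iter (walk-length p) s R z ≡ true
      iter-walk nil R e = e
      iter-walk {x} (cons {y = y} xy p) R e =
        subst (λ S → S _ ≡ true) (iter-shift (walk-length p) R)
          (iter-walk p (s R) (proj₂ (expands R y) (inj₂ (x , adj-sym xy , e))))

      iter-inflationary : ∀ d k R x → iter k s R x ≡ true → iter (d + k) s R x ≡ true
      iter-inflationary zero k R x e = e
      iter-inflationary (suc d) k R x e = proj₂ (expands (iter (d + k) s R) x) (inj₁ (iter-inflationary d k R x e))

    -- n rounds suffice as every walk shortens to one with fewer than n edges.
    iter-complete : ∀ u x → Walk E u x → iter n s (u ==_) x ≡ true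
    iter-complete u x p with short-walk p
    ... | q , q<n = subst (λ k → iter k s (u ==_) x ≡ true) (m∸n+n≡m (≤-trans (n≤1+n _) q<n))
                      (iter-inflationary (n ∸ walk-length q) (walk-length q) (u ==_) x (iter-walk q (u ==_) (==-refl u)))

  graphOf : List (Edge n) → Graph n
  graphOf es x y = any (λ e → (proj₁ e == x) ∧ (proj₂ e == y)) es

  graphOf-sound : ∀ es {x y} → graphOf es x y ≡ true → (x , y) ∈ es
  graphOf-sound es {x} {y} e with any-true⁻ _ es e
  ... | (a , b) , i , h with ==-sound {a} {x} (∧-conicalˡ _ _ h) | ==-sound {b} {y} (∧-conicalʳ _ _ h)
  ... | refl | refl = i

  graphOf-complete : ∀ es {x y} → (x , y) ∈ es → graphOf es x y ≡ true
  graphOf-complete es {x} {y} i = any-true⁺ _ i (∧-true (==-refl x) (==-refl y))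

  step-expands : ∀ es → ExpandsAlong (graphOf es) (step es)
  step-expands es R x = sound , complete
    where
    joins : Edge n → Bool
    joins = λ { (a , b) → ((a == x) ∧ R b) ∨ ((b == x) ∧ R a) }
    sound : step es R x ≡ true → R x ≡ true ⊎ ∃ λ y → Adj (graphOf es) x y × R y ≡ true
    sound e with ∨-true⁻ {R x} e
    ... | inj₁ h = inj₁ h
    ... | inj₂ h with any-true⁻ joins es h
    ... | (a , b) , i , h′ with ∨-true⁻ {(a == x) ∧ R b} h′
    ... | inj₁ h″ with ==-sound {a} {x} (∧-conicalˡ _ _ h″)
    ... | refl = inj₂ (b , fwd (graphOf-complete es i) , ∧-conicalʳ _ _ h″)
    sound e | inj₂ h | (a , b) , i , h′ | inj₂ h″ with ==-sound {b} {x} (∧-conicalˡ _ _ h″)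
    ... | refl = inj₂ (a , bwd (graphOf-complete es i) , ∧-conicalʳ _ _ h″)
    complete : R x ≡ true ⊎ (∃ λ y → Adj (graphOf es) x y × R y ≡ true) → step es R x ≡ true
    complete (inj₁ h) = ∨-trueˡ h
    complete (inj₂ (y , fwd xy , ry)) =
      ∨-trueʳ {R x} (any-true⁺ joins (graphOf-sound es xy) (∨-trueˡ (∧-true (==-refl x) ry)))
    complete (inj₂ (y , bwd yx , ry)) =
      ∨-trueʳ {R x} (any-true⁺ joins (graphOf-sound es yx) (∨-trueʳ {(y == x) ∧ R x} (∧-true (==-refl x) ry)))

  reachable-sound : ∀ es {u x} → reachable es u x ≡ true → Walk (graphOf es) u x
  reachable-sound es = Iteration.iter-sound (graphOf es) (step es) (step-expands es) n _ _

  reachable-complete : ∀ es {u x} → Walk (graphOf es) u x → reachable es u x ≡ true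
  reachable-complete es = Iteration.iter-complete (graphOf es) (step es) (step-expands es) _ _

  connected-sound : ∀ es → connected es ≡ true → Connected (graphOf es)
  connected-sound es e x y = reachable-sound es
    (all-true⁻ _ (allFin n) (all-true⁻ _ (allFin n) e (∈-allFin x)) (∈-allFin y))

  connected-complete : ∀ es → Connected (graphOf es) → connected es ≡ true
  connected-complete es conn =
    all-true⁺ _ (allFin n) (λ {u} _ → all-true⁺ _ (allFin n) (λ {v} _ → reachable-complete es (conn u v)))

  adjᵇ : Graph n → Fin n → Fin n → Bool
  adjᵇ R x y = R x y ∨ R y x

  adjᵇ-sound : ∀ {R x y} → adjᵇ R x y ≡ true → Adj R x y
  adjᵇ-sound {R} {x} {y} e with ∨-true⁻ {R x y} e
  ... | inj₁ h = fwd h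
  ... | inj₂ h = bwd h

  adjᵇ-complete : ∀ {R x y} → Adj R x y → adjᵇ R x y ≡ true
  adjᵇ-complete (fwd e) = ∨-trueˡ e
  adjᵇ-complete {R} {x} {y} (bwd e) = ∨-trueʳ {R x y} e

  stepᴳ : Graph n → (Fin n → Bool) → (Fin n → Bool)
  stepᴳ E R x = R x ∨ any (λ y → adjᵇ E x y ∧ R y) (allFin n)

  stepᴳ-expands : ∀ E → ExpandsAlong E (stepᴳ E)
  stepᴳ-expands E R x = sound , complete
    where
    joins : Fin n → Bool
    joins y = adjᵇ E x y ∧ R y
    sound : stepᴳ E R x ≡ true → R x ≡ true ⊎ ∃ λ y → Adj E x y × R y ≡ true
    sound e with ∨-true⁻ {R x} e
    ... | inj₁ h = inj₁ h
    ... | inj₂ h with any-true⁻ joins (allFin n) h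
    ... | y , _ , h′ = inj₂ (y , adjᵇ-sound {E} (∧-conicalˡ _ _ h′) , ∧-conicalʳ _ _ h′)
    complete : R x ≡ true ⊎ (∃ λ y → Adj E x y × R y ≡ true) → stepᴳ E R x ≡ true
    complete (inj₁ h) = ∨-trueˡ h
    complete (inj₂ (y , xy , ry)) = ∨-trueʳ {R x} (any-true⁺ joins (∈-allFin y) (∧-true (adjᵇ-complete xy) ry))

  walk? : ∀ E x y → Dec (Walk E x y)
  walk? E x y with iter n (stepᴳ E) (x ==_) y in e
  ... | true = yes (Iteration.iter-sound E (stepᴳ E) (stepᴳ-expands E) n x y e)
  ... | false = no (λ p → not-¬ (Iteration.iter-complete E (stepᴳ E) (stepᴳ-expands E) x y p) e)

  -- Edge lists and spanning-tree lists

  record Simple (H : Graph n) : Set where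
    field
      symmetric : ∀ x y → H x y ≡ H y x
      loopless : ∀ x → H x x ≡ false

    adj-true : ∀ {x y} → Adj H x y → H x y ≡ true
    adj-true (fwd e) = e
    adj-true {x} {y} (bwd e) = trans (symmetric x y) e

    ⊑-irreflexive : ∀ {E x y} → E ⊑ H → Adj E x y → x ≢ y
    ⊑-irreflexive s (fwd e) refl = not-¬ (adj-true (s _ _ e)) (loopless _)
    ⊑-irreflexive s (bwd e) refl = not-¬ (adj-true (s _ _ e)) (loopless _)

  Oriented : List (Edge n) → Set
  Oriented L = ∀ {a b} → (a , b) ∈ L → toℕ a < toℕ b

  module _ (G : Graph n) where

    private
      edgesFrom : Fin n → Fin n → List (Edge n)
      edgesFrom i j = if (toℕ i <ᵇ toℕ j) ∧ G i j then (i , j) ∷ [] else []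

    ∈-edges⁻ : ∀ {a b} → (a , b) ∈ edges G → toℕ a < toℕ b × G a b ≡ true
    ∈-edges⁻ {a} {b} i with ∈-concatMap-∃ _ (allFin n) i
    ... | x , _ , i′ with ∈-concatMap-∃ (edgesFrom x) (allFin n) i′
    ... | y , _ , i″ with ∈-if⁻ ((toℕ x <ᵇ toℕ y) ∧ G x y) i″
    ... | c , refl = <ᵇ⇒< (toℕ a) (toℕ b) (Equivalence.from T-≡ (∧-conicalˡ _ _ c)) , ∧-conicalʳ _ _ c

    ∈-edges⁺ : ∀ {a b} → toℕ a < toℕ b → G a b ≡ true → (a , b) ∈ edges G
    ∈-edges⁺ {a} {b} a<b e = ∈-concatMap-∈ _ (∈-allFin a)
      (∈-concatMap-∈ (edgesFrom a) (∈-allFin b) (∈-if⁺ (∧-true (Equivalence.to T-≡ (<⇒<ᵇ a<b)) e)))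

    edges-oriented : Oriented (edges G)
    edges-oriented i = proj₁ (∈-edges⁻ i)

    Unique-edges : Unique (edges G)
    Unique-edges = Unique-concatMap _ (UP.allFin⁺ n)
      (λ x → Unique-concatMap (edgesFrom x) (UP.allFin⁺ n) (λ y → Unique-if ((toℕ x <ᵇ toℕ y) ∧ G x y))
               (λ y z i j → same-target x i j))
      (λ x y i j → let (a , _ , i′) = ∈-concatMap-∃ (edgesFrom x) (allFin n) i
                       (b , _ , j′) = ∈-concatMap-∃ (edgesFrom y) (allFin n) j
                   in same-source i′ j′)
      where
      same-target : ∀ x {y z e} → e ∈ edgesFrom x y → e ∈ edgesFrom x z → y ≡ z
      same-target x {y} {z} i j with ∈-if⁻ ((toℕ x <ᵇ toℕ y) ∧ G x y) i | ∈-if⁻ ((toℕ x <ᵇ toℕ z) ∧ G x z) j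
      ... | _ , refl | _ , refl = refl
      same-source : ∀ {x y a b e} → e ∈ edgesFrom x a → e ∈ edgesFrom y b → x ≡ y
      same-source {x} {y} {a} {b} i j with ∈-if⁻ ((toℕ x <ᵇ toℕ a) ∧ G x a) i | ∈-if⁻ ((toℕ y <ᵇ toℕ b) ∧ G y b) j
      ... | _ , refl | _ , refl = refl

  module _ {L : List (Edge n)} (unique : Unique L) (oriented : Oriented L) where

    private
      picked-∈ : ∀ {a b rest} → ((a , b) , rest) ∈ picks L → (a , b) ∈ L
      picked-∈ i with picks⁻ L i
      ... | xs , ys , refl , refl = ∈-++⁺ʳ xs (here refl)

      picks-⊑ : ∀ {a b rest} → ((a , b) , rest) ∈ picks L → graphOf rest ⊑ (graphOf L ∖[ a , b ])
      picks-⊑ {a} {b} i x y e with picks⁻ L i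
      ... | xs , ys , refl , refl = adj-∖⁺ {graphOf L} (fwd (graphOf-complete L (∈-++-∷⁺ xs xy∈))) ¬ab
        where
        xy∈ : (x , y) ∈ xs ++ ys
        xy∈ = graphOf-sound (xs ++ ys) e
        ¬ab : ¬ SameEdge a b x y
        ¬ab (straight refl refl) = Unique-++-∷ xs unique xy∈ refl
        ¬ab (crossed refl refl) = <-asym (oriented (∈-++-∷⁺ xs xy∈)) (oriented (∈-++⁺ʳ xs (here refl)))

      ⊑-picks : ∀ {a b rest} → ((a , b) , rest) ∈ picks L → (graphOf L ∖[ a , b ]) ⊑ graphOf rest
      ⊑-picks {a} {b} i x y e with picks⁻ L i | ∖-true⁻ {graphOf L} e
      ... | xs , ys , refl , refl | h , ¬ab =
        fwd (graphOf-complete (xs ++ ys) (∈-++-∷⁻ xs (graphOf-sound L h) λ { refl → ¬ab (straight refl refl) }))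

    Tree⇒isSpanningTree : Tree (graphOf L) → isSpanningTree L ≡ true
    Tree⇒isSpanningTree (conn , forest) = ∧-true (connected-complete L conn)
      (all-true⁺ _ (picks L) λ { {(a , b) , rest} i → cong not (¬-not λ r →
        forest a b (graphOf-complete L (picked-∈ i)) (walk-mono (picks-⊑ i) (reachable-sound rest r))) })

    isSpanningTree⇒Tree : isSpanningTree L ≡ true → Tree (graphOf L)
    isSpanningTree⇒Tree e = connected-sound L (∧-conicalˡ _ _ e) , forest
      where
      forest : Forest (graphOf L)
      forest p q pq cyc with picks⁺ L (graphOf-sound L pq)
      ... | rest , i = not-¬ (reachable-complete rest (walk-mono (⊑-picks i) cyc))
                         (not-injective (all-true⁻ _ (picks L) (∧-conicalʳ _ _ e) i))

  adjᵇ-≈ : ∀ {R S} → R ≈ S → ∀ x y → adjᵇ R x y ≡ adjᵇ S x y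
  adjᵇ-≈ {R} {S} (s , t) x y = ≡-from-≡true _ _
    (λ e → adjᵇ-complete (adj-mono s (adjᵇ-sound {R} e))) (λ e → adjᵇ-complete (adj-mono t (adjᵇ-sound {S} e)))

  connected⇒Connected : ∀ {G} → connected (edges G) ≡ true → Connected G
  connected⇒Connected {G} e x y =
    walk-mono (λ a b ab → fwd (proj₂ (∈-edges⁻ G (graphOf-sound (edges G) ab)))) (connected-sound (edges G) e x y)

  edgeList : Graph n → Graph n → List (Edge n)
  edgeList H R = filterᵇ (λ e → adjᵇ R (proj₁ e) (proj₂ e)) (edges H)

  module _ (H : Graph n) where

    edgeList-∈-subsets : ∀ R → edgeList H R ∈ subsets (edges H)
    edgeList-∈-subsets R = filterᵇ-∈-subsets _ (edges H)

    Unique-edgeList : ∀ R → Unique (edgeList H R)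
    Unique-edgeList R = UP.filter⁺ (T? ∘ λ e → adjᵇ R (proj₁ e) (proj₂ e)) (Unique-edges H)

    edgeList-oriented : ∀ R → Oriented (edgeList H R)
    edgeList-oriented R i = edges-oriented H (proj₁ (∈-filterᵇ⁻ _ {edges H} i))

    edgeList-cong : ∀ {R S} → R ≈ S → edgeList H R ≡ edgeList H S
    edgeList-cong R≈S = filterᵇ-cong _ _ (edges H) (λ {z} _ → adjᵇ-≈ R≈S (proj₁ z) (proj₂ z))

    graphOf-edgeList : Simple H → ∀ {R} → R ⊑ H → graphOf (edgeList H R) ≈ R
    graphOf-edgeList simple {R} R⊑H = sound , complete
      where
      open Simple simple
      sound : graphOf (edgeList H R) ⊑ R
      sound x y e = adjᵇ-sound {R} (proj₂ (∈-filterᵇ⁻ _ {edges H} (graphOf-sound (edgeList H R) e)))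
      complete : R ⊑ graphOf (edgeList H R)
      complete x y e with <-cmp (toℕ x) (toℕ y)
      ... | tri< x<y _ _ = fwd (graphOf-complete (edgeList H R)
              (∈-filterᵇ⁺ _ (∈-edges⁺ H x<y (adj-true (R⊑H x y e))) (∨-trueˡ e)))
      ... | tri≈ _ x≡y _ = ⊥-elim (⊑-irreflexive R⊑H (fwd e) (toℕ-injective x≡y))
      ... | tri> _ _ y<x = bwd (graphOf-complete (edgeList H R)
              (∈-filterᵇ⁺ _ (∈-edges⁺ H y<x (adj-true (adj-sym (R⊑H x y e)))) (∨-trueʳ {R y x} e)))

    ∈-subsets⇒≡-edgeList : ∀ {T} → T ∈ subsets (edges H) → T ≡ edgeList H (graphOf T)
    ∈-subsets⇒≡-edgeList {T} i = subset-as-filterᵇ i (Unique-edges H) _ mem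
      where
      mem : ∀ {z} → z ∈ edges H → (adjᵇ (graphOf T) (proj₁ z) (proj₂ z) ≡ true → z ∈ T)
                                  × (z ∈ T → adjᵇ (graphOf T) (proj₁ z) (proj₂ z) ≡ true)
      mem {a , b} ab∈ = into , λ ab∈T → ∨-trueˡ (graphOf-complete T ab∈T)
        where
        into : adjᵇ (graphOf T) a b ≡ true → (a , b) ∈ T
        into e with adjᵇ-sound {graphOf T} e
        ... | fwd h = graphOf-sound T h
        ... | bwd h = ⊥-elim (<-asym (edges-oriented H ab∈) (edges-oriented H (subsets-⊆ i (graphOf-sound T h))))

  tree-≈ : ∀ {E F} → E ≈ F → Tree E → Tree F
  tree-≈ (s , t) (conn , forest) = (λ x y → walk-mono s (conn x y)) , forest-antimono t forest

  SpanningTreeOf : Graph n → Graph n → Set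
  SpanningTreeOf G E = Tree E × E ⊑ G

  spanningTrees : Graph n → List (List (Edge n))
  spanningTrees G = filterᵇ isSpanningTree (subsets (edges G))

  Unique-spanningTrees : ∀ G → Unique (spanningTrees G)
  Unique-spanningTrees G = UP.filter⁺ (T? ∘ isSpanningTree) {subsets (edges G)} (Unique-subsets (Unique-edges G))

  ∈-spanningTrees⁻ : ∀ {G T} → T ∈ spanningTrees G → SpanningTreeOf G (graphOf T)
  ∈-spanningTrees⁻ {G} {T} i with ∈-filterᵇ⁻ isSpanningTree {subsets (edges G)} i
  ... | T∈ , st = isSpanningTree⇒Tree (Unique-∈-subsets T∈ (Unique-edges G)) (λ j → edges-oriented G (subsets-⊆ T∈ j)) st ,
                  λ x y e → fwd (proj₂ (∈-edges⁻ G (subsets-⊆ T∈ (graphOf-sound T e))))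

  ∈-spanningTrees⁺ : ∀ {H R} → Simple H → SpanningTreeOf H R → edgeList H R ∈ spanningTrees H
  ∈-spanningTrees⁺ {H} {R} simple (tree , R⊑H) = ∈-filterᵇ⁺ isSpanningTree (edgeList-∈-subsets H R)
    (Tree⇒isSpanningTree (Unique-edgeList H R) (edgeList-oriented H R) (tree-≈ (≈-sym (graphOf-edgeList H simple R⊑H)) tree))

  edgeList-injective : ∀ {H R S} → Simple H → R ⊑ H → S ⊑ H → edgeList H R ≡ edgeList H S → R ≈ S
  edgeList-injective {H} {R} {S} simple R⊑H S⊑H eq =
    ≈-trans (≈-sym (graphOf-edgeList H simple R⊑H)) (subst (λ L → graphOf L ≈ S) (sym eq) (graphOf-edgeList H simple S⊑H))

  τ-<-injection : ∀ {G H} → Simple H → (φ : Graph n → Graph n) →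
                  (∀ {E} → SpanningTreeOf G E → SpanningTreeOf H (φ E)) →
                  (∀ {E₁ E₂} → SpanningTreeOf G E₁ → SpanningTreeOf G E₂ → φ E₁ ≈ φ E₂ → E₁ ≈ E₂) →
                  ∀ {Y} → SpanningTreeOf H Y → (∀ {E} → SpanningTreeOf G E → ¬ φ E ≈ Y) → τ G < τ H
  τ-<-injection {G} {H} simple φ φ-spanning φ-injective {Y} Y-spanning φ-misses-Y =
    length-<-injection ψ (Unique-spanningTrees G) into injective (∈-spanningTrees⁺ simple Y-spanning) missed
    where
    ψ : List (Edge n) → List (Edge n)
    ψ T = edgeList H (φ (graphOf T))
    image : ∀ {T} → T ∈ spanningTrees G → SpanningTreeOf H (φ (graphOf T))
    image i = φ-spanning (∈-spanningTrees⁻ i)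
    into : ∀ {T} → T ∈ spanningTrees G → ψ T ∈ spanningTrees H
    into i = ∈-spanningTrees⁺ simple (image i)
    injective : ∀ {T₁ T₂} → T₁ ∈ spanningTrees G → T₂ ∈ spanningTrees G → ψ T₁ ≡ ψ T₂ → T₁ ≡ T₂
    injective {T₁} {T₂} i₁ i₂ eq =
      let E₁≈E₂ = φ-injective (∈-spanningTrees⁻ i₁) (∈-spanningTrees⁻ i₂)
                    (edgeList-injective simple (proj₂ (image i₁)) (proj₂ (image i₂)) eq)
      in trans (∈-subsets⇒≡-edgeList G (proj₁ (∈-filterᵇ⁻ isSpanningTree i₁)))
           (trans (edgeList-cong G E₁≈E₂) (sym (∈-subsets⇒≡-edgeList G (proj₁ (∈-filterᵇ⁻ isSpanningTree i₂)))))
    missed : ∀ {T} → T ∈ spanningTrees G → ψ T ≢ edgeList H Y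
    missed i eq = φ-misses-Y (∈-spanningTrees⁻ i) (edgeList-injective simple (proj₂ (image i)) (proj₂ Y-spanning) eq)

  -- Extending a forest to a spanning tree

  extendForest : Graph n → List (Edge n) → Graph n
  extendForest F [] = F
  extendForest F ((a , b) ∷ es) with walk? F a b
  ... | yes _ = extendForest F es
  ... | no _ = extendForest (F +[ a , b ]) es

  extendForest-forest : ∀ {F} es → Forest F → Forest (extendForest F es)
  extendForest-forest [] f = f
  extendForest-forest {F} ((a , b) ∷ es) f with walk? F a b
  ... | yes _ = extendForest-forest es f
  ... | no ¬ab = extendForest-forest es (forest-+ f ¬ab)

  ⊑-extendForest : ∀ {F} es → F ⊑ extendForest F es
  ⊑-extendForest [] = ⊑-refl
  ⊑-extendForest {F} ((a , b) ∷ es) with walk? F a b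
  ... | yes _ = ⊑-extendForest es
  ... | no _ = ⊑-trans (⊑-+ {F}) (⊑-extendForest es)

  extendForest-walk : ∀ {F} es {a b} → (a , b) ∈ es → Walk (extendForest F es) a b
  extendForest-walk {F} ((a , b) ∷ es) (here refl) with walk? F a b
  ... | yes ab = walk-mono (⊑-extendForest es) ab
  ... | no _ = walk-mono (⊑-extendForest es) [ adj-+-new {F} (straight refl refl) ]ʷ
  extendForest-walk {F} ((a , b) ∷ es) (there i) with walk? F a b
  ... | yes _ = extendForest-walk es i
  ... | no _ = extendForest-walk es i

  extendForest-⊑ : ∀ {F H} es → F ⊑ H → (∀ {a b} → (a , b) ∈ es → Adj H a b) → extendForest F es ⊑ H
  extendForest-⊑ [] F⊑H _ = F⊑H
  extendForest-⊑ {F} ((a , b) ∷ es) F⊑H es⊑H with walk? F a b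
  ... | yes _ = extendForest-⊑ es F⊑H (λ i → es⊑H (there i))
  ... | no _ = extendForest-⊑ es (+-⊑ {F} F⊑H (es⊑H (here refl))) (λ i → es⊑H (there i))

  spanning-tree-extension : ∀ {H S} → Simple H → Connected H → Forest S → S ⊑ H →
                            ∃ λ Y → SpanningTreeOf H Y × S ⊑ Y
  spanning-tree-extension {H} {S} simple conn forest S⊑H =
    Y , (((λ x y → walk-lift edge-walk (conn x y)) , extendForest-forest (edges H) forest) ,
         extendForest-⊑ (edges H) S⊑H (λ i → fwd (proj₂ (∈-edges⁻ H i)))) ,
    ⊑-extendForest (edges H)
    where
    open Simple simple
    Y = extendForest S (edges H)
    edge-walk : ∀ a b → H a b ≡ true → Walk Y a b
    edge-walk a b e with <-cmp (toℕ a) (toℕ b)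
    ... | tri< a<b _ _ = extendForest-walk (edges H) (∈-edges⁺ H a<b e)
    ... | tri≈ _ a≡b _ = ⊥-elim (⊑-irreflexive ⊑-refl (fwd e) (toℕ-injective a≡b))
    ... | tri> _ _ b<a = reverseʷ (extendForest-walk (edges H) (∈-edges⁺ H b<a (trans (symmetric b a) e)))

  pathGraph : List (Fin n) → Graph n
  pathGraph (x ∷ y ∷ rest) = pathGraph (y ∷ rest) +[ x , y ]
  pathGraph _ = λ _ _ → false

  pathGraph-vertices : ∀ l {a b} → Adj (pathGraph l) a b → a ∈ l × b ∈ l
  pathGraph-vertices [] (fwd ())
  pathGraph-vertices [] (bwd ())
  pathGraph-vertices (x ∷ []) (fwd ())
  pathGraph-vertices (x ∷ []) (bwd ())
  pathGraph-vertices (x ∷ y ∷ rest) ab =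
    [ Product.map there there ∘ pathGraph-vertices (y ∷ rest) , endpoints ]′ (adj-+⁻ {pathGraph (y ∷ rest)} ab)
    where
    endpoints : ∀ {a b} → SameEdge x y a b → a ∈ x ∷ y ∷ rest × b ∈ x ∷ y ∷ rest
    endpoints (straight refl refl) = here refl , there (here refl)
    endpoints (crossed refl refl) = there (here refl) , here refl

  pathGraph-⊑ : ∀ {G} l → Linked (λ a b → G a b ≡ true) l → pathGraph l ⊑ G
  pathGraph-⊑ [] _ _ _ ()
  pathGraph-⊑ (x ∷ []) _ _ _ ()
  pathGraph-⊑ (x ∷ y ∷ rest) (xy ∷ linked) = +-⊑ {pathGraph (y ∷ rest)} (pathGraph-⊑ (y ∷ rest) linked) (fwd xy)

  pathGraph-walk : ∀ l {a b} → head l ≡ just a → last l ≡ just b → Walk (pathGraph l) a b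
  pathGraph-walk (x ∷ []) refl refl = nil
  pathGraph-walk (x ∷ y ∷ rest) refl e =
    cons (adj-+-new {pathGraph (y ∷ rest)} (straight refl refl))
         (walk-mono (⊑-+ {pathGraph (y ∷ rest)}) (pathGraph-walk (y ∷ rest) refl e))

  pathGraph-forest : ∀ l → Unique l → Forest (pathGraph l)
  pathGraph-forest [] _ _ _ ()
  pathGraph-forest (x ∷ []) _ _ _ ()
  pathGraph-forest (x ∷ y ∷ rest) (x∉ ∷ u) = forest-+ (pathGraph-forest (y ∷ rest) u) λ p →
    All.lookup x∉ (here refl)
      (walk-from-isolated (λ z xz → All.lookup x∉ (proj₁ (pathGraph-vertices (y ∷ rest) xz)) refl) p)

-- Moving the edge vv₁ to wv₁

module Move {n : ℕ} (G : Graph n) (simple : Simple G) (v w v₁ : Fin n) (v≢w : v ≢ w)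
            (N[w]⊆N[v] : ∀ u → G w u ≡ true → u ≡ v ⊎ G v u ≡ true)
            (Gvv₁ : G v v₁ ≡ true) (v₁≢w : v₁ ≢ w) (Gwv₁ : G w v₁ ≡ false) where

  open Simple simple

  G′ : Graph n
  G′ = move G v v₁ w

  v≢v₁ : v ≢ v₁
  v≢v₁ = ⊑-irreflexive ⊑-refl (fwd Gvv₁)

  private
    if-true⁺ : ∀ p q g → p ≡ false → q ≡ true ⊎ g ≡ true → (if p then false else if q then true else g) ≡ true
    if-true⁺ false true _ refl _ = refl
    if-true⁺ false false _ refl (inj₁ ())
    if-true⁺ false false _ refl (inj₂ g) = g

    if-true⁻ : ∀ p q g → (if p then false else if q then true else g) ≡ true → p ≡ false × (q ≡ true ⊎ g ≡ true)
    if-true⁻ false true _ _ = refl , inj₁ refl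
    if-true⁻ false false _ g = refl , inj₂ g

  G′-true⁺ : ∀ {x y} → G x y ≡ true → ¬ SameEdge v v₁ x y → G′ x y ≡ true
  G′-true⁺ {x} {y} g ¬vv₁ = if-true⁺ (sameEdgeᵇ v v₁ x y) _ (G x y) (sameEdgeᵇ-false ¬vv₁) (inj₂ g)

  G′-true⁻ : ∀ {x y} → G′ x y ≡ true → ¬ SameEdge v v₁ x y × (SameEdge w v₁ x y ⊎ G x y ≡ true)
  G′-true⁻ {x} {y} e with if-true⁻ (sameEdgeᵇ v v₁ x y) (sameEdgeᵇ w v₁ x y) (G x y) e
  ... | f , new = (λ p → not-¬ (sameEdgeᵇ-complete p) f) , map₁ (sameEdgeᵇ-sound w v₁ x y) new

  G′-wv₁ : G′ w v₁ ≡ true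
  G′-wv₁ = if-true⁺ (sameEdgeᵇ v v₁ w v₁) (sameEdgeᵇ w v₁ w v₁) (G w v₁)
                    (sameEdgeᵇ-false {x = w} {y = v₁} λ { (straight w≡v _) → v≢w (sym w≡v)
                                                        ; (crossed w≡v₁ _) → v₁≢w (sym w≡v₁) })
                    (inj₁ (sameEdgeᵇ-complete {a = w} {b = v₁} (straight refl refl)))

  G′-simple : Simple G′
  G′-simple = record { symmetric = G′-symmetric ; loopless = λ x → ¬-not (G′-no-loop x ∘ G′-true⁻) }
    where
    G′-symmetric : ∀ x y → G′ x y ≡ G′ y x
    G′-symmetric x y = trans (cong₂ (λ p q → if p then false else if q then true else G x y)
                                    (sameEdgeᵇ-flip v v₁ x y) (sameEdgeᵇ-flip w v₁ x y))
                             (cong (λ g → if sameEdgeᵇ v v₁ y x then false else if sameEdgeᵇ w v₁ y x then true else g)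
                                   (symmetric x y))
    G′-no-loop : ∀ x → ¬ (¬ SameEdge v v₁ x x × (SameEdge w v₁ x x ⊎ G x x ≡ true))
    G′-no-loop x (_ , inj₁ (straight x≡w x≡v₁)) = v₁≢w (trans (sym x≡v₁) x≡w)
    G′-no-loop x (_ , inj₁ (crossed x≡v₁ x≡w)) = v₁≢w (trans (sym x≡v₁) x≡w)
    G′-no-loop x (_ , inj₂ g) = not-¬ g (loopless x)

  adj-G′ : ∀ {x y} → Adj G x y → ¬ SameEdge v v₁ x y → Adj G′ x y
  adj-G′ (fwd g) ¬vv₁ = fwd (G′-true⁺ g ¬vv₁)
  adj-G′ (bwd g) ¬vv₁ = bwd (G′-true⁺ g (¬vv₁ ∘ SameEdge-flip))

  G′-connected : Connected G → Walk G′ v v₁ → Connected G′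
  G′-connected conn vv₁ x y = walk-+-replace ⊑-refl vv₁ (walk-mono G⊑G′+vv₁ (conn x y))
    where
    G⊑G′+vv₁ : G ⊑ (G′ +[ v , v₁ ])
    G⊑G′+vv₁ a b e with sameEdge? v v₁ a b
    ... | yes p = adj-+-new {E = G′} p
    ... | no ¬p = adj-+⁺ {E = G′} (fwd (G′-true⁺ e ¬p))

  cut : Graph n → Graph n
  cut E = E ∖[ v , v₁ ]

  LastExit : Graph n → Set
  LastExit E = ∃ λ u → Adj (cut E) w u × Walk (cut E ∖[ w , u ]) u v₁

  data Case (E : Graph n) : Set where
    keep : ¬ Adj E v v₁ → Case E
    reattach : Adj E v v₁ → Walk (cut E) w v → Case E
    rotate : Adj E v v₁ → ¬ Walk (cut E) w v → (u : Fin n) → Adj (cut E) w u → Walk (cut E ∖[ w , u ]) u v₁ → Case E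
    detached : Adj E v v₁ → ¬ Walk (cut E) w v → ¬ LastExit E → Case E

  classify : (E : Graph n) → Case E
  classify E with adj? E v v₁
  ... | no ¬vv₁ = keep ¬vv₁
  ... | yes vv₁ with walk? (cut E) w v
  ... | yes wv = reattach vv₁ wv
  ... | no ¬wv with any? (λ u → adj? (cut E) w u ×-dec walk? (cut E ∖[ w , u ]) u v₁)
  ... | yes (u , wu , uv₁) = rotate vv₁ ¬wv u wu uv₁
  ... | no ¬exit = detached vv₁ ¬wv ¬exit

  φ : (E : Graph n) → Case E → Graph n
  φ E (keep _) = E
  φ E (reattach _ _) = cut E +[ w , v₁ ]
  φ E (rotate _ _ u _ _) = ((cut E +[ v , u ]) ∖[ w , u ]) +[ w , v₁ ]
  φ E (detached _ _ _) = E   -- never the case for a spanning tree (last-exit-from-w)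

  Φ : Graph n → Graph n
  Φ E = φ E (classify E)

  module _ {E : Graph n} (spanning : SpanningTreeOf G E) where

    private
      tree : Tree E
      tree = proj₁ spanning

      E⊑G : E ⊑ G
      E⊑G = proj₂ spanning

    ¬adj-wv₁ : ¬ Adj E w v₁
    ¬adj-wv₁ wv₁ = not-¬ (adj-true (adj-mono E⊑G wv₁)) Gwv₁

    ¬sameEdge-wv₁ : ∀ {x y} → Adj E x y → ¬ SameEdge w v₁ x y
    ¬sameEdge-wv₁ xy p = ¬adj-wv₁ (adj-sameEdge xy (SameEdge-sym p))

    last-exit-from-w : ¬ Walk (cut E) w v → LastExit E
    last-exit-from-w ¬wv with walk-+-split {E = cut E} (walk-mono (⊑-∖+ {E = E}) (proj₁ tree w v₁))
    ... | inj₁ wv₁ = last-exit (v₁≢w ∘ sym) wv₁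
    ... | inj₂ (inj₁ (wv , _)) = ⊥-elim (¬wv wv)
    ... | inj₂ (inj₂ (wv₁ , _)) = last-exit (v₁≢w ∘ sym) wv₁

    module Rotation (¬wv : ¬ Walk (cut E) w v) {u : Fin n} (wu : Adj (cut E) w u) where

      u≢v : u ≢ v
      u≢v refl = ¬wv [ wu ]ʷ

      E-wu : Adj E w u
      E-wu = proj₁ (adj-∖⁻ {E = E} wu)

      G-wu : G w u ≡ true
      G-wu = adj-true (adj-mono E⊑G E-wu)

      u≢v₁ : u ≢ v₁
      u≢v₁ refl = not-¬ G-wu Gwv₁

      G-vu : G v u ≡ true
      G-vu with N[w]⊆N[v] u G-wu
      ... | inj₁ u≡v = ⊥-elim (u≢v u≡v)
      ... | inj₂ g = g

      ¬cut-vu : ¬ Adj (cut E) v u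
      ¬cut-vu vu = ¬wv ([ wu ]ʷ ++ʷ [ adj-sym vu ]ʷ)

    cut⊑G′ : cut E ⊑ G′
    cut⊑G′ x y e = let (h , ¬vv₁) = adj-∖⁻ {E = E} (fwd e) in adj-G′ (adj-mono E⊑G h) ¬vv₁

    φ-tree : (c : Case E) → Tree (φ E c)
    φ-tree (keep _) = tree
    φ-tree (reattach vv₁ wv) = tree-exchange tree vv₁ wv nil
    φ-tree (rotate vv₁ _ u wu uv₁) =
      tree-exchange (tree-exchange tree vv₁ nil (walk-mono (∖-⊑ {E = cut E}) uv₁)) (adj-+⁺ {E = cut E} wu) nil
                    (reverseʷ (walk-mono (∖-mono (⊑-+ {E = cut E})) uv₁))
    φ-tree (detached _ ¬wv ¬exit) = ⊥-elim (¬exit (last-exit-from-w ¬wv))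

    φ-⊑ : (c : Case E) → φ E c ⊑ G′
    φ-⊑ (keep ¬vv₁) x y e = adj-G′ (E⊑G x y e) λ p → ¬vv₁ (adj-sameEdge (fwd e) (SameEdge-sym p))
    φ-⊑ (reattach _ _) = +-⊑ {E = cut E} cut⊑G′ (fwd G′-wv₁)
    φ-⊑ (rotate _ ¬wv u wu _) =
      +-⊑ {E = (cut E +[ v , u ]) ∖[ w , u ]}
          (⊑-trans (∖-⊑ {E = cut E +[ v , u ]}) (+-⊑ {E = cut E} cut⊑G′ (adj-G′ (fwd G-vu) ¬vv₁-vu)))
          (fwd G′-wv₁)
      where
      open Rotation ¬wv wu
      ¬vv₁-vu : ¬ SameEdge v v₁ v u
      ¬vv₁-vu (straight _ u≡v₁) = u≢v₁ u≡v₁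
      ¬vv₁-vu (crossed v≡v₁ _) = v≢v₁ v≡v₁
    φ-⊑ (detached _ ¬wv ¬exit) = ⊥-elim (¬exit (last-exit-from-w ¬wv))

    φ-spanning : (c : Case E) → SpanningTreeOf G′ (φ E c)
    φ-spanning c = φ-tree c , φ-⊑ c

    reattach-separates : ∀ vv₁ wv → ¬ Walk (φ E (reattach vv₁ wv) ∖[ w , v₁ ]) v v₁
    reattach-separates vv₁ _ p = forest-acyclic (proj₂ tree) vv₁ (walk-mono (+∖-⊑ {E = cut E}) p)

    module RotationImage (vv₁ : Adj E v v₁) (¬wv : ¬ Walk (cut E) w v) (u : Fin n)
                         (wu : Adj (cut E) w u) (uv₁ : Walk (cut E ∖[ w , u ]) u v₁) where

      open Rotation ¬wv wu

      Y : Graph n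
      Y = φ E (rotate vv₁ ¬wv u wu uv₁)

      Y-vu : Adj Y v u
      Y-vu = adj-+⁺ {E = (cut E +[ v , u ]) ∖[ w , u ]}
               (adj-∖⁺ {E = cut E +[ v , u ]} (adj-+-new {E = cut E} (straight refl refl)) ¬wu-vu)
        where
        ¬wu-vu : ¬ SameEdge w u v u
        ¬wu-vu (straight v≡w _) = v≢w v≡w
        ¬wu-vu (crossed v≡u _) = u≢v (sym v≡u)

      Y-embeds : ∀ {x y} → Adj (cut E ∖[ w , u ]) x y → Adj Y x y × ¬ SameEdge v u x y
      Y-embeds xy with adj-∖⁻ {E = cut E} xy
      ... | cut-xy , ¬wu = adj-+⁺ {E = (cut E +[ v , u ]) ∖[ w , u ]}
                               (adj-∖⁺ {E = cut E +[ v , u ]} (adj-+⁺ {E = cut E} cut-xy) ¬wu) ,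
                           λ p → ¬cut-vu (adj-sameEdge cut-xy (SameEdge-sym p))

      Y∖vu-walk : Walk (Y ∖[ v , u ]) u v₁
      Y∖vu-walk = walk-mono (λ x y e → let (h , ¬vu) = Y-embeds (fwd e) in adj-∖⁺ {E = Y} h ¬vu) uv₁

      Y∖wv₁-walk : Walk (Y ∖[ w , v₁ ]) v v₁
      Y∖wv₁-walk = cons (adj-∖⁺ {E = Y} Y-vu ¬wv₁-vu) (walk-mono embed uv₁)
        where
        ¬wv₁-vu : ¬ SameEdge w v₁ v u
        ¬wv₁-vu (straight v≡w _) = v≢w v≡w
        ¬wv₁-vu (crossed v≡v₁ _) = v≢v₁ v≡v₁
        embed : (cut E ∖[ w , u ]) ⊑ (Y ∖[ w , v₁ ])
        embed x y e = adj-∖⁺ {E = Y} (proj₁ (Y-embeds (fwd e)))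
                        (¬sameEdge-wv₁ (proj₁ (adj-∖⁻ {E = E} (proj₁ (adj-∖⁻ {E = cut E} (fwd e))))))

      Y-edge⁻ : ∀ {x y} → Adj Y x y → ¬ SameEdge w v₁ x y → Adj (cut E) x y ⊎ SameEdge v u x y
      Y-edge⁻ xy ¬wv₁ with adj-+⁻ {E = (cut E +[ v , u ]) ∖[ w , u ]} xy
      ... | inj₂ p = ⊥-elim (¬wv₁ p)
      ... | inj₁ h = adj-+⁻ {E = cut E} (proj₁ (adj-∖⁻ {E = cut E +[ v , u ]} h))

  φ-reflects : ∀ {E₁ E₂} → SpanningTreeOf G E₁ → SpanningTreeOf G E₂ →
               (c₁ : Case E₁) (c₂ : Case E₂) → φ E₁ c₁ ≈ φ E₂ c₂ → E₁ ⊑ E₂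
  φ-reflects st₁ _ (detached _ ¬wv ¬exit) _ _ = ⊥-elim (¬exit (last-exit-from-w st₁ ¬wv))
  φ-reflects _ st₂ _ (detached _ ¬wv ¬exit) _ = ⊥-elim (¬exit (last-exit-from-w st₂ ¬wv))
  φ-reflects _ _ (keep _) (keep _) (E₁⊑E₂ , _) = E₁⊑E₂
  φ-reflects {E₂ = E₂} st₁ _ (keep _) (reattach _ _) (_ , φ₂⊑E₁) =
    ⊥-elim (¬adj-wv₁ st₁ (adj-mono φ₂⊑E₁ (adj-+-new {E = cut E₂} (straight refl refl))))
  φ-reflects {E₂ = E₂} st₁ _ (keep _) (rotate _ _ u _ _) (_ , φ₂⊑E₁) =
    ⊥-elim (¬adj-wv₁ st₁ (adj-mono φ₂⊑E₁ (adj-+-new {E = (cut E₂ +[ v , u ]) ∖[ w , u ]} (straight refl refl))))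
  φ-reflects {E₁} _ st₂ (reattach _ _) (keep _) (φ₁⊑E₂ , _) =
    ⊥-elim (¬adj-wv₁ st₂ (adj-mono φ₁⊑E₂ (adj-+-new {E = cut E₁} (straight refl refl))))
  φ-reflects {E₁} _ st₂ (rotate _ _ u _ _) (keep _) (φ₁⊑E₂ , _) =
    ⊥-elim (¬adj-wv₁ st₂ (adj-mono φ₁⊑E₂ (adj-+-new {E = (cut E₁ +[ v , u ]) ∖[ w , u ]} (straight refl refl))))
  φ-reflects st₁ st₂ (reattach vv₁′ wv) (rotate vv₁ ¬wv u wu uv₁) (_ , φ₂⊑φ₁) =
    ⊥-elim (reattach-separates st₁ vv₁′ wv
              (walk-mono (∖-mono φ₂⊑φ₁) (RotationImage.Y∖wv₁-walk st₂ vv₁ ¬wv u wu uv₁)))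
  φ-reflects st₁ st₂ (rotate vv₁ ¬wv u wu uv₁) (reattach vv₁′ wv) (φ₁⊑φ₂ , _) =
    ⊥-elim (reattach-separates st₂ vv₁′ wv
              (walk-mono (∖-mono φ₁⊑φ₂) (RotationImage.Y∖wv₁-walk st₁ vv₁ ¬wv u wu uv₁)))
  φ-reflects {E₁} {E₂} st₁ _ (reattach _ _) (reattach vv₁ _) (φ₁⊑φ₂ , _) x y e with sameEdge? v v₁ x y
  ... | yes p = adj-sameEdge vv₁ p
  ... | no ¬vv₁ with adj-+⁻ {E = cut E₂} (adj-mono φ₁⊑φ₂ (adj-+⁺ {E = cut E₁} (adj-∖⁺ {E = E₁} (fwd e) ¬vv₁)))
  ... | inj₁ cut₂-xy = proj₁ (adj-∖⁻ {E = E₂} cut₂-xy)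
  ... | inj₂ p = ⊥-elim (¬sameEdge-wv₁ st₁ (fwd e) p)
  φ-reflects {E₁} {E₂} st₁ st₂ (rotate vv₁₁ ¬wv₁ u₁ wu₁ uv₁₁) (rotate vv₁₂ ¬wv₂ u₂ wu₂ uv₁₂) φ₁≈φ₂ x y e
    with forest-first-step-unique (proj₂ (φ-tree st₁ (rotate vv₁₁ ¬wv₁ u₁ wu₁ uv₁₁)))
           (Image₁.Y-vu) (adj-mono (proj₂ φ₁≈φ₂) Image₂.Y-vu)
           Image₁.Y∖vu-walk (walk-mono (proj₂ (∖-≈ φ₁≈φ₂)) Image₂.Y∖vu-walk)
    where
    module Image₁ = RotationImage st₁ vv₁₁ ¬wv₁ u₁ wu₁ uv₁₁
    module Image₂ = RotationImage st₂ vv₁₂ ¬wv₂ u₂ wu₂ uv₁₂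
  ... | refl with sameEdge? v v₁ x y | sameEdge? w u₁ x y
  ... | yes p | _ = adj-sameEdge vv₁₂ p
  ... | no _ | yes p = adj-sameEdge (Rotation.E-wu st₂ ¬wv₂ wu₂) p
  ... | no ¬vv₁ | no ¬wu with RotationImage.Y-edge⁻ st₂ vv₁₂ ¬wv₂ u₁ wu₂ uv₁₂
                                (adj-mono (proj₁ φ₁≈φ₂) (proj₁ (RotationImage.Y-embeds st₁ vv₁₁ ¬wv₁ u₁ wu₁ uv₁₁ cut₁-xy)))
                                (¬sameEdge-wv₁ st₁ (fwd e))
    where
    cut₁-xy : Adj (cut E₁ ∖[ w , u₁ ]) x y
    cut₁-xy = adj-∖⁺ {E = cut E₁} (adj-∖⁺ {E = E₁} (fwd e) ¬vv₁) ¬wu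
  ... | inj₁ cut₂-xy = proj₁ (adj-∖⁻ {E = E₂} cut₂-xy)
  ... | inj₂ p = ⊥-elim (Rotation.¬cut-vu st₁ ¬wv₁ wu₁ (adj-sameEdge (adj-∖⁺ {E = E₁} (fwd e) ¬vv₁) (SameEdge-sym p)))

  Φ-spanning : ∀ {E} → SpanningTreeOf G E → SpanningTreeOf G′ (Φ E)
  Φ-spanning {E} st = φ-spanning st (classify E)

  Φ-injective : ∀ {E₁ E₂} → SpanningTreeOf G E₁ → SpanningTreeOf G E₂ → Φ E₁ ≈ Φ E₂ → E₁ ≈ E₂
  Φ-injective {E₁} {E₂} st₁ st₂ q =
    φ-reflects st₁ st₂ (classify E₁) (classify E₂) q , φ-reflects st₂ st₁ (classify E₂) (classify E₁) (≈-sym q)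

  Φ-misses : ∀ {E Q} → SpanningTreeOf G E → Walk Q v v₁ → (∀ {x y} → Adj Q x y → x ≢ w) →
             (∀ {t} → Adj Q v t → G w t ≡ false) → Q ⊑ Φ E → ¬ Adj (Φ E) w v₁
  Φ-misses {E} {Q} st Q-vv₁ Q-avoids-w Q-v-nbrs Q⊑ = misses (classify E) Q⊑
    where
    ¬wv₁ : ∀ {x y} → Adj Q x y → ¬ SameEdge w v₁ x y
    ¬wv₁ xy (straight x≡w _) = Q-avoids-w xy x≡w
    ¬wv₁ xy (crossed _ y≡w) = Q-avoids-w (adj-sym xy) y≡w
    cycle : Adj E v v₁ → Q ⊑ cut E → ⊥
    cycle vv₁ Q⊑cut = forest-acyclic (proj₂ (proj₁ st)) vv₁ (walk-mono Q⊑cut Q-vv₁)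
    misses : (c : Case E) → Q ⊑ φ E c → ¬ Adj (φ E c) w v₁
    misses (keep _) _ wv₁ = ¬adj-wv₁ st wv₁
    misses (reattach vv₁ _) Q⊑φ _ = cycle vv₁ Q⊑cut
      where
      Q⊑cut : Q ⊑ cut E
      Q⊑cut x y e with adj-+⁻ {E = cut E} (Q⊑φ x y e)
      ... | inj₁ h = h
      ... | inj₂ p = ⊥-elim (¬wv₁ (fwd e) p)
    misses (rotate vv₁ ¬wv u wu uv₁) Q⊑φ _ = cycle vv₁ Q⊑cut
      where
      Q⊑cut : Q ⊑ cut E
      Q⊑cut x y e with RotationImage.Y-edge⁻ st vv₁ ¬wv u wu uv₁ (Q⊑φ x y e) (¬wv₁ (fwd e))
      ... | inj₁ h = h
      ... | inj₂ p = ⊥-elim (not-¬ (Rotation.G-wu st ¬wv wu) (Q-v-nbrs (adj-sameEdge (fwd e) (SameEdge-sym p))))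
    misses (detached _ ¬wv ¬exit) = ⊥-elim (¬exit (last-exit-from-w st ¬wv))

module MissedTree {n : ℕ} (G : Graph n) (simple : Simple G) (G-connected : Connected G)
                  (v w : Fin n) (v≢w : v ≢ w) (N[w]⊆N[v] : ∀ u → G w u ≡ true → u ≡ v ⊎ G v u ≡ true)
                  (v₁ v₂ : Fin n) (v₁≢v₂ : v₁ ≢ v₂)
                  (Gvv₁ : G v v₁ ≡ true) (v₁≢w : v₁ ≢ w) (Gwv₁ : G w v₁ ≡ false)
                  (Gvv₂ : G v v₂ ≡ true) (v₂≢w : v₂ ≢ w) (Gwv₂ : G w v₂ ≡ false)
                  (P : List (Fin n)) (P-head : head P ≡ just v₁) (P-last : last P ≡ just v₂)
                  (P-linked : Linked (λ a b → G a b ≡ true) P) (P-unique : Unique P)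
                  (P-outside : All (λ x → (x ≢ w) × (G w x ≡ false) × (x ≢ v)) P) where

  open Simple simple
  open Move G simple v w v₁ v≢w N[w]⊆N[v] Gvv₁ v₁≢w Gwv₁

  v≢v₂ : v ≢ v₂
  v≢v₂ = ⊑-irreflexive ⊑-refl (fwd Gvv₂)

  detour : Graph n
  detour = pathGraph P +[ v , v₂ ]

  private
    outside : ∀ {x y} → Adj (pathGraph P) x y → (x ≢ w) × (G w x ≡ false) × (x ≢ v)
    outside xy = All.lookup P-outside (proj₁ (pathGraph-vertices P xy))

  detour-walk : Walk detour v v₁
  detour-walk = cons (adj-+-new {E = pathGraph P} (straight refl refl))
                (walk-mono (⊑-+ {E = pathGraph P}) (reverseʷ (pathGraph-walk P P-head P-last)))

  detour-avoids-w : ∀ {x y} → Adj detour x y → x ≢ w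
  detour-avoids-w xy with adj-+⁻ {E = pathGraph P} xy
  ... | inj₁ h = proj₁ (outside h)
  ... | inj₂ (straight refl refl) = v≢w
  ... | inj₂ (crossed refl refl) = v₂≢w

  detour-v-neighbours : ∀ {t} → Adj detour v t → G w t ≡ false
  detour-v-neighbours vt with adj-+⁻ {E = pathGraph P} vt
  ... | inj₁ h = ⊥-elim (proj₂ (proj₂ (outside h)) refl)
  ... | inj₂ (straight _ refl) = Gwv₂
  ... | inj₂ (crossed v≡v₂ _) = ⊥-elim (v≢v₂ v≡v₂)

  detour-avoids-vv₁ : ∀ {x y} → Adj detour x y → ¬ SameEdge v v₁ x y
  detour-avoids-vv₁ xy p with adj-+⁻ {E = pathGraph P} xy | p
  ... | inj₁ h | straight x≡v _ = proj₂ (proj₂ (outside h)) x≡v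
  ... | inj₁ h | crossed _ y≡v = proj₂ (proj₂ (outside (adj-sym h))) y≡v
  ... | inj₂ (straight refl refl) | straight _ v₂≡v₁ = v₁≢v₂ (sym v₂≡v₁)
  ... | inj₂ (straight refl refl) | crossed _ v₂≡v = v≢v₂ (sym v₂≡v)
  ... | inj₂ (crossed refl refl) | straight v₂≡v _ = v≢v₂ (sym v₂≡v)
  ... | inj₂ (crossed refl refl) | crossed v₂≡v₁ _ = v₁≢v₂ (sym v₂≡v₁)

  detour-forest : Forest detour
  detour-forest = forest-+ (pathGraph-forest P P-unique)
    (v≢v₂ ∘ walk-from-isolated (λ _ vz → proj₂ (proj₂ (outside vz)) refl))

  detour⊑G : detour ⊑ G
  detour⊑G = +-⊑ {E = pathGraph P} (pathGraph-⊑ P P-linked) (fwd Gvv₂)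

  detour⊑G′ : detour ⊑ G′
  detour⊑G′ x y e = adj-G′ (detour⊑G x y e) (detour-avoids-vv₁ (fwd e))

  S : Graph n
  S = detour +[ w , v₁ ]

  S-forest : Forest S
  S-forest = forest-+ detour-forest (v₁≢w ∘ sym ∘ walk-from-isolated (λ _ wz → detour-avoids-w wz refl))

  S⊑G′ : S ⊑ G′
  S⊑G′ = +-⊑ {E = detour} detour⊑G′ (fwd G′-wv₁)

  extension : ∃ λ Y → SpanningTreeOf G′ Y × S ⊑ Y
  extension = spanning-tree-extension G′-simple (G′-connected G-connected (walk-mono detour⊑G′ detour-walk))
                                      S-forest S⊑G′

  Y : Graph n
  Y = proj₁ extension

  Y-spanning : SpanningTreeOf G′ Y
  Y-spanning = proj₁ (proj₂ extension)

  Φ-misses-Y : ∀ {E} → SpanningTreeOf G E → ¬ Φ E ≈ Y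
  Φ-misses-Y spanning (_ , Y⊑Φ) = Φ-misses spanning detour-walk detour-avoids-w detour-v-neighbours
    (⊑-trans (⊑-trans (⊑-+ {E = detour}) S⊑Y) Y⊑Φ)
    (adj-mono (⊑-trans S⊑Y Y⊑Φ) (adj-+-new {E = detour} (straight refl refl)))
    where
    S⊑Y : S ⊑ Y
    S⊑Y = proj₂ (proj₂ extension)

lemma2p1 : ∀ {n : ℕ} (G : Graph n)
    → (∀ x y → G x y ≡ G y x)
    → (∀ x → G x x ≡ false)
    → connected (edges G) ≡ true
    → (v w : Fin n) → v ≢ w
    → (∀ u → G w u ≡ true → u ≡ v ⊎ G v u ≡ true)
    → (v₁ v₂ : Fin n) → v₁ ≢ v₂
    → G v v₁ ≡ true → v₁ ≢ w → G w v₁ ≡ false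
    → G v v₂ ≡ true → v₂ ≢ w → G w v₂ ≡ false
    → (P : List (Fin n))
    → head P ≡ just v₁ → last P ≡ just v₂
    → Linked (λ a b → G a b ≡ true) P
    → AllPairs _≢_ P
    → All (λ x → (x ≢ w) × (G w x ≡ false) × (x ≢ v)) P
    → τ G < τ (move G v v₁ w)
lemma2p1 G symmetric loopless G-connected v w v≢w N[w]⊆N[v] v₁ v₂ v₁≢v₂ Gvv₁ v₁≢w Gwv₁ Gvv₂ v₂≢w Gwv₂
         P P-head P-last P-linked P-unique P-outside =
  τ-<-injection G′-simple Φ Φ-spanning Φ-injective Y-spanning Φ-misses-Y
  where
  simple : Simple G
  simple = record { symmetric = symmetric ; loopless = loopless }
  open Move G simple v w v₁ v≢w N[w]⊆N[v] Gvv₁ v₁≢w Gwv₁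
  open MissedTree G simple (connected⇒Connected G-connected) v w v≢w N[w]⊆N[v] v₁ v₂ v₁≢v₂
                  Gvv₁ v₁≢w Gwv₁ Gvv₂ v₂≢w Gwv₂ P P-head P-last P-linked P-unique P-outside
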